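{- For every 2-edge-coloring $(G^r,G^b)$ of the complete tripartite graph $K_{3,3,4}$ (i.e. every partition of its edge set into spanning subgraphs $G^r$ and $G^b$), either $G^r$ contains a copy of $C_3$ or $G^b$ contains a copy of $C_4$.
   Context: $K_{3,3,4}$ is the complete tripartite graph with parts of sizes $3,3,4$; $C_m$ is the cycle on $m$ vertices. -}

module Defs where

open import Data.Nat using (ℕ; _<_)
open import Data.Fin using (Fin; toℕ)
open import Data.Bool using (Bool; true; false)
open import Data.Product using (_×_; ∃-syntax)
open import Relation.Binary.PropositionalEquality using (_≡_)
open import Relation.Nullary using (¬_)

-- Vertices of K_{3,3,4}: Fin 10.  Part 0 = {0,1,2}, part 1 = {3,4,5}, part 2 = {6,7,8,9}.
part : Fin 10 → ℕ
part v with toℕ v Data.Nat.<? 3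
... | Relation.Nullary.yes _ = 0
... | Relation.Nullary.no _ with toℕ v Data.Nat.<? 6
...   | Relation.Nullary.yes _ = 1
...   | Relation.Nullary.no _ = 2

Adj : Fin 10 → Fin 10 → Set
Adj u v = ¬ (part u ≡ part v)

-- A 2-edge-colouring: each pair gets a colour (true = red, false = blue),
-- symmetric so that each (undirected) edge has one colour.  Only values on
-- edges matter.
record Colouring : Set where
  field
    col : Fin 10 → Fin 10 → Bool
    sym : ∀ u v → col u v ≡ col v u
open Colouring public

RedEdge : Colouring → Fin 10 → Fin 10 → Set
RedEdge c u v = Adj u v × col c u v ≡ true

BlueEdge : Colouring → Fin 10 → Fin 10 → Set
BlueEdge c u v = Adj u v × col c u v ≡ false

HasRedC3 : Colouring → Set
HasRedC3 c = ∃[ x ] ∃[ y ] ∃[ z ]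
  (¬ x ≡ y × ¬ y ≡ z × ¬ x ≡ z)
  × RedEdge c x y × RedEdge c y z × RedEdge c z x

HasBlueC4 : Colouring → Set
HasBlueC4 c = ∃[ a ] ∃[ b ] ∃[ d ] ∃[ e ]
  (¬ a ≡ b × ¬ a ≡ d × ¬ a ≡ e × ¬ b ≡ d × ¬ b ≡ e × ¬ d ≡ e)
  × BlueEdge c a b × BlueEdge c b d × BlueEdge c d e × BlueEdge c e a

-- Proof by an exhaustive case analysis on edge colours, recorded as a certificate: a binary
-- tree whose inner nodes fix the colour of one edge of K_{3,3,4} and whose 2053 leaves each
-- name a red triangle or a blue 4-cycle among the edges fixed on the way down.  The tree was
-- found by a computer search branching first on the edges lying in the most nearly completed
-- monochromatic triangles and 4-cycles; Agda checks it by evaluation.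
module Submission where

open import Defs
open import Data.Bool using (Bool; true; false)
open import Data.Bool.Properties using () renaming (_≟_ to _≟ᵇ_)
open import Data.Fin using (Fin)
open import Data.Fin.Properties using (_≟_)
open import Data.List using (List; []; _∷_)
open import Data.List.Relation.Unary.All using (All; []; _∷_)
open import Data.Maybe using (Maybe; just; nothing)
open import Data.Maybe.Properties using () renaming (≡-dec to ≡-decᵐ)
open import Data.Nat using (ℕ)
open import Data.Nat.DivMod using (_mod_)
open import Data.Nat.Properties using () renaming (_≟_ to _≟ℕ_)
open import Data.Product using (_×_; _,_; map₂)
open import Data.Product.Properties using (≡-dec)
open import Data.Sum using (_⊎_; inj₁; inj₂)
open import Relation.Binary.Definitions using (DecidableEquality)
open import Relation.Binary.PropositionalEquality using (_≡_; refl; trans)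
open import Relation.Nullary using (Dec; yes; no; ¬_; ¬?; _×-dec_)
open import Relation.Nullary.Decidable using (from-yes)

_≟ᵉ_ : DecidableEquality (ℕ × ℕ)
_≟ᵉ_ = ≡-dec _≟ℕ_ _≟ℕ_

_≟ᵐ_ : DecidableEquality (Maybe Bool)
_≟ᵐ_ = ≡-decᵐ _≟ᵇ_

-- Certificates name vertices by natural numbers; only codes below 10 occur, `mod` just makes
-- the decoding total.
vertex : ℕ → Fin 10
vertex k = k mod 10

PartialColouring : Set
PartialColouring = List (ℕ × ℕ × Bool)

_extends_ : Colouring → PartialColouring → Set
c extends σ = All (λ (u , v , b) → col c (vertex u) (vertex v) ≡ b) σ

colourOf : PartialColouring → ℕ → ℕ → Maybe Bool
colourOf [] u v = nothing
colourOf ((x , y , b) ∷ σ) u v with (x , y) ≟ᵉ (u , v) | (y , x) ≟ᵉ (u , v)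
... | yes _ | _     = just b
... | no _  | yes _ = just b
... | no _  | no _  = colourOf σ u v

col-colourOf : ∀ c {σ u v b} → c extends σ → colourOf σ u v ≡ just b →
               col c (vertex u) (vertex v) ≡ b
col-colourOf c {(x , y , _) ∷ σ} {u} {v} (xy ∷ ext) eq
  with (x , y) ≟ᵉ (u , v) | (y , x) ≟ᵉ (u , v)
col-colourOf c (xy ∷ ext) refl | yes refl | _        = xy
col-colourOf c (xy ∷ ext) refl | no _     | yes refl = trans (Colouring.sym c _ _) xy
col-colourOf c (xy ∷ ext) eq   | no _     | no _     = col-colourOf c ext eq

ColouredEdge : PartialColouring → Bool → ℕ → ℕ → Set
ColouredEdge σ b u v = Adj (vertex u) (vertex v) × colourOf σ u v ≡ just b

colouredEdge? : ∀ σ b u v → Dec (ColouredEdge σ b u v)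
colouredEdge? σ b u v = ¬? (part (vertex u) ≟ℕ part (vertex v)) ×-dec colourOf σ u v ≟ᵐ just b

_≢ᵛ_ : ℕ → ℕ → Set
u ≢ᵛ v = ¬ vertex u ≡ vertex v

_≢ᵛ?_ : ∀ u v → Dec (u ≢ᵛ v)
u ≢ᵛ? v = ¬? (vertex u ≟ vertex v)

RedC3In : PartialColouring → ℕ → ℕ → ℕ → Set
RedC3In σ x y z =
  (x ≢ᵛ y × y ≢ᵛ z × x ≢ᵛ z)
  × ColouredEdge σ true x y × ColouredEdge σ true y z × ColouredEdge σ true z x

redC3In? : ∀ σ x y z → Dec (RedC3In σ x y z)
redC3In? σ x y z =
  (x ≢ᵛ? y ×-dec y ≢ᵛ? z ×-dec x ≢ᵛ? z)
  ×-dec colouredEdge? σ true x y ×-dec colouredEdge? σ true y z ×-dec colouredEdge? σ true z x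

BlueC4In : PartialColouring → ℕ → ℕ → ℕ → ℕ → Set
BlueC4In σ a b d e =
  (a ≢ᵛ b × a ≢ᵛ d × a ≢ᵛ e × b ≢ᵛ d × b ≢ᵛ e × d ≢ᵛ e)
  × ColouredEdge σ false a b × ColouredEdge σ false b d
  × ColouredEdge σ false d e × ColouredEdge σ false e a

blueC4In? : ∀ σ a b d e → Dec (BlueC4In σ a b d e)
blueC4In? σ a b d e =
  (a ≢ᵛ? b ×-dec a ≢ᵛ? d ×-dec a ≢ᵛ? e ×-dec b ≢ᵛ? d ×-dec b ≢ᵛ? e ×-dec d ≢ᵛ? e)
  ×-dec colouredEdge? σ false a b ×-dec colouredEdge? σ false b d
  ×-dec colouredEdge? σ false d e ×-dec colouredEdge? σ false e a

module _ (c : Colouring) {σ : PartialColouring} (ext : c extends σ) where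

  edge-colour : ∀ {b u v} → ColouredEdge σ b u v →
                Adj (vertex u) (vertex v) × col c (vertex u) (vertex v) ≡ b
  edge-colour = map₂ (col-colourOf c ext)

  redC3In⇒hasRedC3 : ∀ {x y z} → RedC3In σ x y z → HasRedC3 c
  redC3In⇒hasRedC3 {x} {y} {z} (distinct , xy , yz , zx) =
    vertex x , vertex y , vertex z , distinct , edge-colour xy , edge-colour yz , edge-colour zx

  blueC4In⇒hasBlueC4 : ∀ {a b d e} → BlueC4In σ a b d e → HasBlueC4 c
  blueC4In⇒hasBlueC4 {a} {b} {d} {e} (distinct , ab , bd , de , ea) =
    vertex a , vertex b , vertex d , vertex e , distinct ,
    edge-colour ab , edge-colour bd , edge-colour de , edge-colour ea

data Certificate : Set where
  red   : ℕ → ℕ → ℕ → Certificate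
  blue  : ℕ → ℕ → ℕ → ℕ → Certificate
  split : ℕ → ℕ → Certificate → Certificate → Certificate

Valid : PartialColouring → Certificate → Set
Valid σ (red x y z)     = RedC3In σ x y z
Valid σ (blue a b d e)  = BlueC4In σ a b d e
Valid σ (split u v r s) = Valid ((u , v , true) ∷ σ) r × Valid ((u , v , false) ∷ σ) s

valid? : ∀ σ t → Dec (Valid σ t)
valid? σ (red x y z)     = redC3In? σ x y z
valid? σ (blue a b d e)  = blueC4In? σ a b d e
valid? σ (split u v r s) = valid? ((u , v , true) ∷ σ) r ×-dec valid? ((u , v , false) ∷ σ) s

valid⇒red⊎blue : ∀ c {σ} t → c extends σ → Valid σ t → HasRedC3 c ⊎ HasBlueC4 c
valid⇒red⊎blue c (red x y z)     ext v = inj₁ (redC3In⇒hasRedC3 c ext v)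
valid⇒red⊎blue c (blue a b d e)  ext v = inj₂ (blueC4In⇒hasBlueC4 c ext v)
valid⇒red⊎blue c (split u v r s) ext (vr , vs) with col c (vertex u) (vertex v) in uv
... | true  = valid⇒red⊎blue c r (uv ∷ ext) vr
... | false = valid⇒red⊎blue c s (uv ∷ ext) vs

certificate : Certificate
certificate =
  split 0 3 (split 0 6 (split 3 6 (red 0 3 6) (split 4 6 (split 0 4 (red 0 4 6) (split 0 5 (split 5
  6 (red 0 5 6) (split 3 7 (split 0 7 (red 0 3 7) (split 1 4 (split 1 6 (red 1 4 6) (split 1 7
  (split 1 3 (red 1 3 7) (split 1 5 (split 4 7 (red 1 4 7) (split 5 7 (red 1 5 7) (split 5 8 (split
  0 8 (red 0 5 8) (split 1 8 (red 1 5 8) (split 3 8 (split 4 8 (split 2 8 (split 2 3 (red 2 3 8)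
  (split 2 4 (red 2 4 8) (split 2 5 (red 2 5 8) (blue 2 3 6 5)))) (split 2 3 (split 2 4 (split 2 6
  (red 2 4 6) (blue 1 6 2 8)) (blue 0 4 2 8)) (blue 1 3 2 8))) (blue 0 7 4 8)) (blue 1 6 3 8))))
  (split 0 8 (split 1 8 (split 3 8 (red 0 3 8) (blue 3 6 5 8)) (blue 1 6 5 8)) (blue 0 7 5 8)))))
  (blue 1 3 6 5))) (split 5 7 (split 2 7 (split 2 3 (red 2 3 7) (split 2 5 (red 2 5 7) (blue 2 3 6
  5))) (split 2 4 (split 2 6 (red 2 4 6) (blue 1 6 2 7)) (blue 0 4 2 7))) (blue 1 6 5 7)))) (split
  1 7 (split 1 3 (red 1 3 7) (split 1 5 (split 5 7 (red 1 5 7) (split 5 8 (split 0 8 (red 0 5 8)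
  (split 1 8 (red 1 5 8) (blue 0 4 1 8))) (split 0 8 (split 3 8 (red 0 3 8) (blue 3 6 5 8)) (blue 0
  7 5 8)))) (blue 1 3 6 5))) (blue 0 4 1 7)))) (split 5 7 (split 0 7 (red 0 5 7) (split 3 8 (split
  0 8 (red 0 3 8) (split 0 9 (split 3 9 (red 0 3 9) (split 5 9 (red 0 5 9) (blue 3 6 5 9))) (split
  3 9 (split 1 7 (split 1 5 (red 1 5 7) (split 1 3 (split 1 8 (red 1 3 8) (split 1 4 (split 1 6
  (red 1 4 6) (split 1 9 (red 1 3 9) (blue 0 8 1 9))) (blue 0 4 1 8))) (blue 1 3 6 5))) (split 1 4
  (split 1 6 (red 1 4 6) (blue 1 6 3 7)) (blue 0 4 1 7))) (blue 0 7 3 9)))) (split 0 8 (split 5 8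
  (red 0 5 8) (blue 3 6 5 8)) (blue 0 7 3 8)))) (blue 3 6 5 7)))) (split 1 4 (split 1 6 (red 1 4 6)
  (split 2 4 (split 2 6 (red 2 4 6) (split 1 7 (split 4 7 (red 1 4 7) (split 5 7 (split 1 5 (red 1
  5 7) (split 2 5 (split 2 7 (red 2 5 7) (split 3 7 (split 0 7 (red 0 3 7) (split 1 3 (red 1 3 7)
  (split 2 3 (split 5 6 (split 2 8 (split 3 8 (red 2 3 8) (split 1 8 (split 4 8 (red 1 4 8) (split
  0 8 (split 5 8 (red 2 5 8) (blue 0 4 8 5)) (blue 0 7 4 8))) (blue 1 6 3 8))) (split 0 8 (split 1
  8 (split 3 8 (red 0 3 8) (blue 2 6 3 8)) (blue 1 6 2 8)) (blue 0 7 2 8))) (blue 1 3 6 5)) (blue 1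
  3 2 6)))) (blue 2 6 3 7))) (blue 1 5 2 6))) (blue 0 4 7 5))) (split 2 7 (split 3 7 (split 0 7
  (red 0 3 7) (split 1 5 (split 2 3 (red 2 3 7) (split 1 3 (split 4 7 (red 2 4 7) (split 5 7 (split
  2 5 (red 2 5 7) (split 5 6 (split 1 8 (split 3 8 (red 1 3 8) (split 2 8 (split 4 8 (red 1 4 8)
  (split 0 8 (split 5 8 (red 1 5 8) (blue 0 4 8 5)) (blue 0 7 4 8))) (blue 2 6 3 8))) (split 0 8
  (split 2 8 (split 3 8 (red 0 3 8) (blue 1 6 3 8)) (blue 1 6 2 8)) (blue 0 7 1 8))) (blue 2 3 6
  5))) (blue 0 4 7 5))) (blue 1 3 2 6))) (blue 0 5 1 7))) (blue 1 6 3 7)) (blue 1 6 2 7)))) (split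
  2 5 (split 1 7 (split 4 7 (red 1 4 7) (split 5 7 (split 1 5 (red 1 5 7) (split 2 7 (red 2 5 7)
  (split 0 7 (split 3 7 (red 0 3 7) (split 2 3 (split 2 6 (split 5 6 (red 2 5 6) (split 1 3 (split
  3 8 (split 0 8 (red 0 3 8) (split 1 8 (red 1 3 8) (blue 0 5 1 8))) (split 1 8 (split 2 8 (split 4
  8 (red 1 4 8) (blue 3 7 4 8)) (blue 2 7 3 8)) (blue 1 6 3 8))) (blue 1 3 6 5))) (blue 2 6 3 7))
  (blue 2 3 7 4))) (blue 0 4 2 7)))) (blue 0 4 7 5))) (split 3 7 (split 0 7 (red 0 3 7) (split 1 5
  (split 2 7 (split 2 3 (red 2 3 7) (split 5 7 (red 2 5 7) (split 4 7 (split 5 6 (split 2 6 (red 2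
  5 6) (split 1 3 (split 1 8 (split 3 8 (red 1 3 8) (split 2 8 (split 4 8 (red 1 4 8) (blue 2 3 8
  4)) (blue 2 6 3 8))) (split 0 8 (split 2 8 (split 3 8 (red 0 3 8) (blue 1 6 3 8)) (blue 1 6 2 8))
  (blue 0 7 1 8))) (blue 1 3 2 6))) (blue 1 6 5 7)) (blue 0 4 7 5)))) (blue 0 4 2 7)) (blue 0 5 1
  7))) (blue 1 6 3 7))) (blue 0 4 2 5)))) (split 1 5 (split 2 4 (split 2 6 (red 2 4 6) (split 2 7
  (split 4 7 (red 2 4 7) (split 5 7 (split 1 7 (red 1 5 7) (split 0 7 (split 2 5 (red 2 5 7) (split
  3 7 (red 0 3 7) (split 1 3 (split 1 6 (split 5 6 (red 1 5 6) (split 2 3 (split 3 8 (split 0 8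
  (red 0 3 8) (split 1 8 (red 1 3 8) (blue 0 4 1 8))) (split 1 8 (split 2 8 (split 4 8 (red 2 4 8)
  (blue 3 7 4 8)) (blue 2 6 3 8)) (blue 1 7 3 8))) (blue 2 3 6 5))) (blue 1 6 3 7)) (blue 1 3 7
  4)))) (blue 0 4 1 7))) (blue 0 4 7 5))) (split 3 7 (split 0 7 (red 0 3 7) (split 1 7 (split 1 3
  (red 1 3 7) (split 2 5 (split 5 7 (red 1 5 7) (split 4 7 (split 5 6 (split 1 6 (red 1 5 6) (split
  2 3 (split 2 8 (split 3 8 (red 2 3 8) (split 1 8 (split 4 8 (red 2 4 8) (blue 1 3 8 4)) (blue 1 6
  3 8))) (split 0 8 (split 1 8 (split 3 8 (red 0 3 8) (blue 2 6 3 8)) (blue 1 6 2 8)) (blue 0 7 2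
  8))) (blue 1 3 2 6))) (blue 2 6 5 7)) (blue 0 4 7 5))) (blue 0 5 2 7))) (blue 0 4 1 7))) (blue 2
  6 3 7)))) (split 2 5 (split 5 7 (split 1 7 (red 1 5 7) (split 0 7 (split 2 7 (red 2 5 7) (blue 1
  4 2 7)) (blue 0 4 1 7))) (split 4 7 (split 5 8 (split 1 8 (red 1 5 8) (split 0 8 (split 2 8 (red
  2 5 8) (blue 1 4 2 8)) (blue 0 4 1 8))) (split 4 8 (split 5 6 (split 1 6 (red 1 5 6) (split 2 6
  (red 2 5 6) (blue 1 4 2 6))) (split 3 7 (split 0 7 (red 0 3 7) (split 0 8 (split 1 7 (split 1 3
  (red 1 3 7) (split 2 3 (split 2 7 (red 2 3 7) (blue 0 4 2 7)) (blue 1 3 2 4))) (blue 0 4 1 7))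
  (blue 0 7 5 8))) (blue 3 6 5 7))) (blue 0 4 8 5))) (blue 0 4 7 5))) (blue 0 4 2 5))) (blue 0 4 1
  5))))) (split 3 7 (split 0 7 (red 0 3 7) (split 3 8 (split 0 8 (red 0 3 8) (split 1 3 (split 1 7
  (red 1 3 7) (split 1 8 (red 1 3 8) (blue 0 7 1 8))) (split 1 4 (split 2 3 (split 2 7 (red 2 3 7)
  (split 2 8 (red 2 3 8) (blue 0 7 2 8))) (split 2 4 (split 4 9 (split 1 9 (red 1 4 9) (split 2 9
  (red 2 4 9) (blue 1 3 2 9))) (split 3 9 (split 0 9 (red 0 3 9) (split 4 7 (split 1 7 (red 1 4 7)
  (split 1 8 (split 1 9 (split 2 7 (red 2 4 7) (blue 1 3 2 7)) (blue 0 7 1 9)) (blue 0 7 1 8)))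
  (blue 0 7 4 9))) (blue 3 6 4 9))) (blue 2 3 6 4))) (blue 1 3 6 4)))) (split 4 8 (split 5 6 (split
  0 5 (red 0 5 6) (split 3 9 (split 0 9 (red 0 3 9) (split 1 5 (split 1 6 (red 1 5 6) (split 1 8
  (split 1 4 (red 1 4 8) (split 1 3 (split 1 7 (red 1 3 7) (split 0 4 (split 0 8 (red 0 4 8) (split
  1 9 (red 1 3 9) (blue 0 7 1 9))) (blue 0 4 1 7))) (blue 1 3 6 4))) (blue 1 6 3 8))) (split 1 7
  (split 1 3 (red 1 3 7) (split 1 4 (split 1 8 (red 1 4 8) (split 0 8 (split 0 4 (red 0 4 8) (split
  1 6 (split 1 9 (split 4 7 (red 1 4 7) (split 4 9 (red 1 4 9) (blue 0 7 4 9))) (blue 0 5 1 9))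
  (blue 1 6 3 8))) (blue 0 5 1 8))) (blue 1 3 6 4))) (blue 0 5 1 7)))) (split 4 9 (split 1 4 (split
  1 8 (red 1 4 8) (split 1 6 (split 1 5 (red 1 5 6) (split 0 8 (split 0 4 (red 0 4 8) (split 1 7
  (split 1 3 (red 1 3 7) (split 1 9 (red 1 4 9) (blue 1 8 3 9))) (blue 0 5 1 7))) (blue 0 5 1 8)))
  (blue 1 6 3 8))) (split 1 3 (split 1 7 (red 1 3 7) (split 0 4 (split 0 8 (red 0 4 8) (split 0 9
  (red 0 4 9) (blue 0 8 3 9))) (blue 0 4 1 7))) (blue 1 3 6 4))) (blue 3 6 4 9)))) (split 5 8
  (split 3 9 (split 0 9 (red 0 3 9) (split 1 3 (split 1 7 (red 1 3 7) (split 1 9 (red 1 3 9) (blue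
  0 7 1 9))) (split 1 4 (split 1 5 (split 1 8 (red 1 4 8) (split 1 6 (split 2 3 (split 2 7 (red 2 3
  7) (split 2 9 (red 2 3 9) (blue 0 7 2 9))) (split 2 4 (split 2 5 (split 2 8 (red 2 4 8) (blue 1 3
  2 8)) (blue 2 3 6 5)) (blue 2 3 6 4))) (blue 1 6 3 8))) (blue 1 3 6 5)) (blue 1 3 6 4)))) (split
  4 9 (split 5 9 (split 1 4 (split 1 8 (red 1 4 8) (split 1 6 (split 1 9 (red 1 4 9) (blue 1 8 3
  9)) (blue 1 6 3 8))) (split 1 3 (split 1 5 (split 1 7 (red 1 3 7) (split 0 4 (split 0 8 (red 0 4
  8) (split 0 9 (red 0 4 9) (blue 0 8 3 9))) (blue 0 4 1 7))) (blue 1 4 6 5)) (blue 1 3 6 4)))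
  (blue 3 6 5 9)) (blue 3 6 4 9))) (blue 3 6 5 8))) (blue 3 6 4 8)))) (split 4 7 (split 5 6 (split
  0 5 (red 0 5 6) (split 3 8 (split 0 8 (red 0 3 8) (split 3 9 (split 0 9 (red 0 3 9) (split 1 5
  (split 1 6 (red 1 5 6) (split 1 7 (split 1 4 (red 1 4 7) (split 1 3 (split 1 8 (red 1 3 8) (split
  0 4 (split 0 7 (red 0 4 7) (split 1 9 (red 1 3 9) (blue 0 8 1 9))) (blue 0 4 1 8))) (blue 1 3 6
  4))) (blue 1 6 3 7))) (split 1 8 (split 1 3 (red 1 3 8) (split 1 4 (split 1 7 (red 1 4 7) (split
  0 7 (split 0 4 (red 0 4 7) (split 1 6 (split 1 9 (split 4 8 (red 1 4 8) (split 4 9 (red 1 4 9)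
  (blue 0 8 4 9))) (blue 0 5 1 9)) (blue 1 6 3 7))) (blue 0 5 1 7))) (blue 1 3 6 4))) (blue 0 5 1
  8)))) (split 4 9 (split 1 4 (split 1 7 (red 1 4 7) (split 1 6 (split 1 5 (red 1 5 6) (split 0 7
  (split 0 4 (red 0 4 7) (split 1 8 (split 1 3 (red 1 3 8) (split 1 9 (red 1 4 9) (blue 1 7 3 9)))
  (blue 0 5 1 8))) (blue 0 5 1 7))) (blue 1 6 3 7))) (split 1 3 (split 1 8 (red 1 3 8) (split 0 4
  (split 0 7 (red 0 4 7) (split 0 9 (red 0 4 9) (blue 0 7 3 9))) (blue 0 4 1 8))) (blue 1 3 6 4)))
  (blue 3 6 4 9)))) (split 4 8 (split 3 9 (split 0 9 (red 0 3 9) (split 1 4 (split 1 7 (red 1 4 7)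
  (split 1 6 (split 1 5 (red 1 5 6) (split 0 7 (split 0 4 (red 0 4 7) (split 1 8 (red 1 4 8) (blue
  1 7 3 8))) (blue 0 5 1 7))) (blue 1 6 3 7))) (split 1 3 (split 1 9 (red 1 3 9) (split 0 4 (split
  0 7 (red 0 4 7) (split 0 8 (red 0 4 8) (blue 0 7 3 8))) (blue 0 4 1 9))) (blue 1 3 6 4)))) (split
  4 9 (split 1 4 (split 1 7 (red 1 4 7) (split 1 6 (split 1 5 (red 1 5 6) (split 0 7 (split 0 4
  (red 0 4 7) (split 1 8 (red 1 4 8) (blue 1 7 3 8))) (blue 0 5 1 7))) (blue 1 6 3 7))) (split 1 3
  (split 2 4 (split 2 7 (red 2 4 7) (split 2 6 (split 2 5 (red 2 5 6) (split 0 7 (split 0 4 (red 0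
  4 7) (split 1 5 (split 1 6 (red 1 5 6) (split 1 7 (split 1 8 (split 1 9 (split 2 8 (red 2 4 8)
  (blue 2 7 3 8)) (blue 1 6 3 9)) (blue 1 6 3 8)) (blue 1 6 3 7))) (blue 0 4 1 5))) (blue 0 5 2
  7))) (blue 2 6 3 7))) (split 2 3 (split 0 4 (split 0 7 (red 0 4 7) (split 0 8 (red 0 4 8) (blue 0
  7 3 8))) (split 1 5 (split 1 6 (red 1 5 6) (split 1 7 (split 1 8 (split 1 9 (split 2 5 (split 2 6
  (red 2 5 6) (blue 1 4 2 6)) (blue 0 4 2 5)) (blue 1 6 3 9)) (blue 1 6 3 8)) (blue 1 6 3 7)))
  (blue 0 4 1 5))) (blue 2 3 6 4))) (blue 1 3 6 4))) (blue 3 6 4 9))) (blue 3 6 4 8)))) (split 5 7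
  (split 3 8 (split 0 8 (red 0 3 8) (split 3 9 (split 0 9 (red 0 3 9) (split 1 3 (split 1 8 (red 1
  3 8) (split 1 9 (red 1 3 9) (blue 0 8 1 9))) (split 1 4 (split 1 5 (split 1 7 (red 1 4 7) (split
  1 6 (split 2 3 (split 2 8 (red 2 3 8) (split 2 9 (red 2 3 9) (blue 0 8 2 9))) (split 2 4 (split 2
  5 (split 2 7 (red 2 4 7) (blue 1 3 2 7)) (blue 2 3 6 5)) (blue 2 3 6 4))) (blue 1 6 3 7))) (blue
  1 3 6 5)) (blue 1 3 6 4)))) (split 4 9 (split 5 9 (split 1 4 (split 1 7 (red 1 4 7) (split 1 6
  (split 1 9 (red 1 4 9) (blue 1 7 3 9)) (blue 1 6 3 7))) (split 1 3 (split 1 5 (split 1 7 (red 1 5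
  7) (split 1 6 (split 1 8 (red 1 3 8) (split 0 4 (split 0 7 (red 0 4 7) (blue 0 7 1 8)) (blue 0 4
  1 8))) (blue 1 6 3 7))) (blue 1 4 6 5)) (blue 1 3 6 4))) (blue 3 6 5 9)) (blue 3 6 4 9)))) (split
  4 8 (split 5 8 (split 1 4 (split 1 7 (red 1 4 7) (split 1 6 (split 1 8 (red 1 4 8) (blue 1 7 3
  8)) (blue 1 6 3 7))) (split 1 3 (split 1 5 (split 1 7 (red 1 5 7) (split 1 6 (split 1 8 (red 1 5
  8) (blue 1 7 3 8)) (blue 1 6 3 7))) (blue 1 4 6 5)) (blue 1 3 6 4))) (blue 3 6 5 8)) (blue 3 6 4
  8))) (blue 3 6 5 7))) (blue 3 6 4 7))))) (split 0 7 (split 3 7 (red 0 3 7) (split 3 8 (split 0 8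
  (red 0 3 8) (split 1 8 (split 1 3 (red 1 3 8) (split 1 4 (split 4 8 (red 1 4 8) (split 4 6 (split
  1 6 (red 1 4 6) (split 2 6 (split 2 4 (red 2 4 6) (split 2 3 (split 2 8 (red 2 3 8) (split 0 4
  (split 3 6 (red 2 3 6) (split 1 7 (split 4 7 (red 0 4 7) (split 2 7 (split 5 7 (split 0 5 (red 0
  5 7) (split 1 5 (red 1 5 7) (blue 0 5 1 6))) (split 1 5 (split 2 5 (split 5 6 (red 2 5 6) (blue 3
  6 5 7)) (blue 2 4 7 5)) (blue 1 3 7 5))) (blue 2 7 4 8))) (blue 1 6 3 7))) (blue 0 4 2 8)))
  (split 4 7 (split 0 4 (red 0 4 7) (split 1 7 (red 1 4 7) (split 2 7 (split 2 8 (split 3 6 (split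
  2 5 (split 5 6 (red 2 5 6) (split 5 7 (red 2 5 7) (blue 1 6 5 7))) (split 0 5 (split 1 5 (split 5
  7 (red 0 5 7) (blue 2 3 7 5)) (blue 1 3 2 5)) (blue 0 4 2 5))) (blue 1 6 3 7)) (blue 0 4 2 8))
  (blue 1 3 2 7)))) (blue 2 3 7 4)))) (split 2 3 (split 2 8 (red 2 3 8) (blue 0 6 2 8)) (blue 1 3 2
  6)))) (blue 0 6 4 8))) (split 4 7 (split 0 4 (red 0 4 7) (split 1 6 (split 1 5 (split 5 6 (red 1
  5 6) (split 5 8 (red 1 5 8) (blue 0 6 5 8))) (split 0 5 (split 5 7 (red 0 5 7) (blue 1 3 7 5))
  (blue 0 4 1 5))) (blue 0 4 1 6))) (blue 1 3 7 4)))) (split 1 6 (split 2 8 (split 2 3 (red 2 3 8)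
  (split 0 9 (split 3 9 (red 0 3 9) (split 2 4 (split 4 8 (red 2 4 8) (split 4 6 (split 1 4 (red 1
  4 6) (split 0 4 (split 2 6 (red 2 4 6) (split 4 7 (red 0 4 7) (split 1 3 (split 1 7 (split 3 6
  (red 1 3 6) (split 2 7 (split 2 9 (split 4 9 (red 0 4 9) (blue 3 7 4 9)) (blue 2 6 3 9)) (blue 2
  6 3 7))) (blue 1 7 4 8)) (blue 1 3 7 4)))) (blue 0 4 1 8))) (blue 0 6 4 8))) (split 4 7 (split 0
  4 (red 0 4 7) (split 1 4 (split 1 7 (red 1 4 7) (split 1 9 (split 2 6 (split 4 6 (red 1 4 6)
  (split 3 6 (split 1 3 (red 1 3 6) (split 2 7 (split 4 8 (split 4 9 (red 1 4 9) (blue 2 3 9 4))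
  (blue 0 6 4 8)) (blue 1 3 2 7))) (blue 2 3 6 4))) (blue 0 4 2 6)) (blue 1 7 3 9))) (blue 0 4 1
  8))) (blue 2 3 7 4)))) (split 1 9 (split 1 4 (split 4 6 (red 1 4 6) (split 4 8 (split 2 4 (red 2
  4 8) (split 3 6 (split 1 3 (red 1 3 6) (split 4 7 (split 0 4 (red 0 4 7) (split 1 7 (red 1 4 7)
  (split 2 6 (split 2 7 (split 2 9 (split 4 9 (red 1 4 9) (blue 0 6 4 9)) (blue 0 4 2 9)) (blue 1 3
  2 7)) (blue 0 4 2 6)))) (blue 2 3 7 4))) (blue 2 3 6 4))) (blue 0 6 4 8))) (split 0 4 (split 4 7
  (red 0 4 7) (split 1 3 (split 2 4 (split 3 6 (red 1 3 6) (split 3 9 (red 1 3 9) (blue 0 6 3 9)))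
  (blue 2 3 7 4)) (blue 1 3 7 4))) (blue 0 4 1 8))) (blue 0 8 1 9)))) (split 2 6 (split 0 9 (split
  3 9 (red 0 3 9) (split 0 4 (split 4 7 (red 0 4 7) (split 4 9 (red 0 4 9) (blue 3 7 4 9))) (split
  1 4 (split 2 4 (split 4 6 (red 1 4 6) (split 4 8 (split 0 5 (split 5 7 (red 0 5 7) (split 5 9
  (red 0 5 9) (blue 3 7 5 9))) (split 1 5 (split 2 5 (split 5 6 (red 1 5 6) (blue 0 4 6 5)) (blue 0
  5 2 8)) (blue 0 5 1 8))) (blue 0 6 4 8))) (blue 0 4 2 8)) (blue 0 4 1 8)))) (split 1 9 (split 2 9
  (split 1 4 (split 4 6 (red 1 4 6) (split 4 8 (split 4 9 (red 1 4 9) (blue 0 6 4 9)) (blue 0 6 4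
  8))) (split 0 4 (split 2 4 (split 4 6 (red 2 4 6) (split 4 7 (red 0 4 7) (split 1 3 (split 3 6
  (red 1 3 6) (blue 3 6 4 7)) (blue 1 3 7 4)))) (blue 1 4 2 8)) (blue 0 4 1 8))) (blue 0 8 2 9))
  (blue 0 8 1 9))) (blue 0 6 2 8))) (blue 0 6 1 8)))) (split 4 7 (split 0 4 (red 0 4 7) (split 1 4
  (split 1 7 (red 1 4 7) (split 1 8 (split 4 8 (red 1 4 8) (split 5 8 (split 1 5 (red 1 5 8) (split
  3 9 (split 0 9 (red 0 3 9) (split 0 5 (split 0 8 (red 0 5 8) (split 3 6 (split 4 6 (split 1 6
  (red 1 4 6) (split 1 9 (split 1 3 (red 1 3 9) (split 4 9 (red 1 4 9) (blue 0 8 4 9))) (blue 0 6 1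
  9))) (blue 0 6 4 8)) (blue 0 6 3 8))) (split 1 6 (split 1 9 (split 1 3 (red 1 3 9) (split 4 6
  (red 1 4 6) (split 0 8 (split 3 6 (split 4 9 (red 1 4 9) (blue 0 6 4 9)) (blue 3 6 4 8)) (blue 0
  6 4 8)))) (blue 0 5 1 9)) (blue 0 5 1 6)))) (split 1 9 (split 4 9 (red 1 4 9) (blue 3 8 4 9))
  (blue 1 7 3 9)))) (split 0 5 (split 5 7 (red 0 5 7) (blue 3 7 5 8)) (blue 0 4 8 5)))) (blue 1 7 3
  8))) (split 1 6 (split 2 4 (split 2 7 (red 2 4 7) (split 2 8 (split 4 8 (red 2 4 8) (split 1 3
  (split 3 6 (red 1 3 6) (split 0 8 (split 2 6 (split 4 6 (red 2 4 6) (blue 3 6 4 8)) (blue 2 6 3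
  7)) (blue 0 6 3 8))) (blue 1 3 8 4))) (blue 2 7 3 8))) (split 2 6 (split 1 5 (split 5 6 (red 1 5
  6) (split 3 6 (split 1 3 (red 1 3 6) (split 2 3 (red 2 3 6) (blue 1 3 2 4))) (split 0 8 (split 5
  7 (split 0 5 (red 0 5 7) (split 1 7 (red 1 5 7) (split 1 8 (split 2 5 (split 2 7 (red 2 5 7)
  (blue 1 4 2 7)) (blue 0 4 2 5)) (blue 1 7 3 8)))) (blue 3 6 5 7)) (blue 0 6 3 8)))) (split 0 5
  (split 2 5 (split 5 6 (red 2 5 6) (split 4 6 (split 5 7 (red 0 5 7) (split 1 3 (split 3 6 (red 1
  3 6) (blue 3 6 5 7)) (blue 1 3 7 5))) (blue 1 4 6 5))) (blue 1 4 2 5)) (blue 0 4 1 5))) (blue 0 4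
  2 6))) (blue 0 4 1 6)))) (split 4 8 (split 5 7 (split 0 5 (red 0 5 7) (split 3 9 (split 0 9 (red
  0 3 9) (split 1 5 (split 1 7 (red 1 5 7) (split 1 8 (split 1 4 (red 1 4 8) (split 1 3 (split 1 9
  (red 1 3 9) (split 0 4 (split 0 8 (red 0 4 8) (split 1 6 (split 3 6 (red 1 3 6) (blue 0 6 3 8))
  (blue 0 6 1 9))) (blue 0 4 1 9))) (blue 1 3 7 4))) (blue 1 7 3 8))) (split 1 6 (split 1 9 (split
  1 3 (red 1 3 9) (split 1 4 (split 1 8 (red 1 4 8) (split 0 8 (split 0 4 (red 0 4 8) (split 1 7
  (split 4 6 (red 1 4 6) (split 3 6 (split 4 9 (red 1 4 9) (blue 0 6 4 9)) (blue 3 6 4 7))) (blue 1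
  7 3 8))) (blue 0 5 1 8))) (blue 1 3 7 4))) (blue 0 5 1 9)) (blue 0 5 1 6)))) (split 4 9 (split 1
  4 (split 1 8 (red 1 4 8) (split 1 7 (split 1 5 (red 1 5 7) (split 0 8 (split 0 4 (red 0 4 8)
  (split 1 6 (split 1 9 (red 1 4 9) (blue 1 8 3 9)) (blue 0 5 1 6))) (blue 0 5 1 8))) (blue 1 7 3
  8))) (split 1 3 (split 0 4 (split 0 8 (red 0 4 8) (split 0 9 (red 0 4 9) (blue 0 8 3 9))) (split
  1 5 (split 1 6 (split 1 7 (red 1 5 7) (split 1 8 (split 1 9 (split 3 6 (red 1 3 6) (split 0 8
  (split 0 9 (split 4 6 (split 5 6 (red 1 5 6) (split 5 8 (red 1 5 8) (blue 3 6 5 8))) (blue 3 6 4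
  7)) (blue 0 6 3 9)) (blue 0 6 3 8))) (blue 1 7 3 9)) (blue 1 7 3 8))) (blue 0 4 1 6)) (blue 0 4 1
  5))) (blue 1 3 7 4))) (blue 3 7 4 9)))) (split 5 8 (split 3 9 (split 0 9 (red 0 3 9) (split 0 8
  (split 0 4 (red 0 4 8) (split 0 5 (red 0 5 8) (blue 0 4 7 5))) (split 3 6 (split 1 8 (split 1 4
  (red 1 4 8) (split 1 3 (split 1 5 (red 1 5 8) (blue 1 4 7 5)) (blue 1 3 7 4))) (split 1 6 (split
  1 3 (red 1 3 6) (split 1 4 (split 1 5 (split 1 7 (split 1 9 (split 4 6 (red 1 4 6) (split 4 9
  (red 1 4 9) (blue 0 6 4 9))) (blue 0 8 1 9)) (blue 1 7 3 8)) (blue 1 3 7 5)) (blue 1 3 7 4)))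
  (blue 0 6 1 8))) (blue 0 6 3 8)))) (split 4 9 (split 5 9 (split 1 4 (split 1 8 (red 1 4 8) (split
  1 7 (split 1 9 (red 1 4 9) (blue 1 8 3 9)) (blue 1 7 3 8))) (split 1 3 (split 1 5 (split 1 8 (red
  1 5 8) (split 1 7 (split 1 9 (red 1 5 9) (blue 1 8 3 9)) (blue 1 7 3 8))) (blue 1 4 7 5)) (blue 1
  3 7 4))) (blue 3 7 5 9)) (blue 3 7 4 9))) (blue 3 7 5 8))) (blue 3 7 4 8))))) (split 0 8 (split 3
  8 (red 0 3 8) (split 0 9 (split 3 9 (red 0 3 9) (split 4 8 (split 0 4 (red 0 4 8) (split 1 4
  (split 1 8 (red 1 4 8) (split 1 9 (split 4 9 (red 1 4 9) (split 5 9 (split 0 5 (red 0 5 9) (split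
  1 5 (red 1 5 9) (split 1 6 (split 1 7 (split 4 6 (red 1 4 6) (split 3 6 (split 1 3 (red 1 3 6)
  (split 4 7 (red 1 4 7) (blue 0 6 4 7))) (blue 3 6 4 9))) (blue 0 5 1 7)) (blue 0 5 1 6)))) (split
  0 5 (split 5 8 (red 0 5 8) (blue 3 8 5 9)) (blue 0 4 9 5)))) (blue 1 8 3 9))) (split 1 6 (split 1
  7 (split 1 5 (split 5 6 (red 1 5 6) (split 5 7 (red 1 5 7) (blue 0 6 5 7))) (split 0 5 (split 5 8
  (red 0 5 8) (split 1 3 (split 3 6 (red 1 3 6) (split 3 7 (red 1 3 7) (blue 0 6 3 7))) (blue 1 3 8
  5))) (blue 0 4 1 5))) (blue 0 4 1 7)) (blue 0 4 1 6)))) (split 4 9 (split 0 4 (red 0 4 9) (split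
  1 4 (split 1 9 (red 1 4 9) (split 1 8 (split 5 8 (split 0 5 (red 0 5 8) (split 1 5 (red 1 5 8)
  (split 1 6 (split 1 7 (split 4 6 (red 1 4 6) (split 3 6 (split 1 3 (red 1 3 6) (split 4 7 (red 1
  4 7) (blue 0 6 4 7))) (blue 3 6 4 8))) (blue 0 5 1 7)) (blue 0 5 1 6)))) (split 0 5 (split 5 9
  (red 0 5 9) (blue 3 8 5 9)) (blue 0 4 8 5))) (blue 1 8 3 9))) (split 1 3 (split 1 6 (split 1 7
  (split 3 6 (red 1 3 6) (split 3 7 (red 1 3 7) (blue 0 6 3 7))) (blue 0 4 1 7)) (blue 0 4 1 6))
  (blue 1 3 8 4)))) (blue 3 8 4 9)))) (split 4 8 (split 0 4 (red 0 4 8) (split 1 4 (split 1 8 (red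
  1 4 8) (split 2 4 (split 2 8 (red 2 4 8) (split 1 6 (split 4 6 (red 1 4 6) (split 4 7 (split 1 7
  (red 1 4 7) (split 1 9 (split 2 7 (red 2 4 7) (blue 1 7 2 8)) (blue 0 7 1 9))) (blue 0 6 4 7)))
  (split 1 7 (split 1 9 (split 2 6 (split 3 6 (split 2 3 (red 2 3 6) (split 1 3 (split 3 7 (red 1 3
  7) (split 2 7 (split 3 9 (red 1 3 9) (blue 0 7 3 9)) (blue 2 7 3 8))) (blue 1 3 2 8))) (blue 1 6
  3 8)) (blue 1 6 2 8)) (blue 0 6 1 9)) (blue 0 6 1 7)))) (split 2 6 (split 2 7 (split 2 9 (split 2
  5 (split 5 6 (red 2 5 6) (split 5 7 (red 2 5 7) (blue 0 6 5 7))) (split 0 5 (split 5 8 (red 0 5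
  8) (split 2 3 (split 3 6 (red 2 3 6) (split 1 6 (split 3 7 (red 2 3 7) (blue 0 6 3 7)) (blue 1 6
  3 8))) (blue 2 3 8 5))) (blue 0 4 2 5))) (blue 0 4 2 9)) (blue 0 4 2 7)) (blue 0 4 2 6)))) (split
  1 6 (split 1 7 (split 1 9 (split 1 5 (split 5 6 (red 1 5 6) (split 5 7 (red 1 5 7) (blue 0 6 5
  7))) (split 0 5 (split 5 8 (red 0 5 8) (split 1 3 (split 3 6 (red 1 3 6) (split 3 7 (red 1 3 7)
  (blue 0 6 3 7))) (blue 1 3 8 5))) (blue 0 4 1 5))) (blue 0 4 1 9)) (blue 0 4 1 7)) (blue 0 4 1
  6)))) (split 5 8 (split 0 5 (red 0 5 8) (split 1 5 (split 1 8 (red 1 5 8) (split 1 6 (split 5 6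
  (red 1 5 6) (split 5 7 (split 1 7 (red 1 5 7) (split 1 9 (split 3 7 (split 4 7 (split 5 9 (red 1
  5 9) (blue 0 6 5 9)) (blue 1 7 4 8)) (blue 1 7 3 8)) (blue 0 7 1 9))) (blue 0 6 5 7))) (split 1 7
  (split 1 9 (split 3 6 (split 4 6 (split 5 7 (red 1 5 7) (split 5 6 (split 5 9 (red 1 5 9) (blue 0
  7 5 9)) (blue 0 6 5 7))) (blue 1 6 4 8)) (blue 1 6 3 8)) (blue 0 6 1 9)) (blue 0 6 1 7)))) (split
  1 6 (split 1 7 (split 1 9 (split 1 4 (split 4 6 (red 1 4 6) (split 3 6 (split 1 3 (red 1 3 6)
  (split 4 7 (red 1 4 7) (blue 0 6 4 7))) (blue 3 6 4 8))) (split 0 4 (split 1 3 (split 3 6 (red 1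
  3 6) (split 3 7 (red 1 3 7) (blue 0 6 3 7))) (blue 1 3 8 4)) (blue 0 4 1 5))) (blue 0 5 1 9))
  (blue 0 5 1 7)) (blue 0 5 1 6)))) (split 4 6 (split 1 6 (split 1 4 (red 1 4 6) (split 1 3 (split
  1 5 (split 3 6 (red 1 3 6) (split 3 7 (split 1 7 (red 1 3 7) (split 0 4 (split 1 9 (split 3 9
  (red 1 3 9) (blue 0 6 3 9)) (blue 0 7 1 9)) (blue 0 4 1 7))) (blue 0 6 3 7))) (blue 1 4 8 5))
  (blue 1 3 8 4))) (split 1 7 (split 1 9 (split 1 5 (split 5 7 (red 1 5 7) (split 3 7 (split 1 3
  (red 1 3 7) (split 1 4 (split 4 7 (red 1 4 7) (blue 4 7 5 8)) (blue 1 3 8 4))) (blue 3 7 5 8)))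
  (split 0 5 (split 1 3 (split 1 4 (split 3 7 (red 1 3 7) (split 3 6 (split 3 9 (red 1 3 9) (blue 0
  7 3 9)) (blue 0 6 3 7))) (blue 1 4 8 5)) (blue 1 3 8 5)) (blue 0 5 1 6))) (blue 0 6 1 9)) (blue 0
  6 1 7))) (split 3 6 (split 4 7 (split 4 9 (split 5 6 (split 1 6 (split 1 3 (red 1 3 6) (split 1 4
  (split 1 5 (red 1 5 6) (blue 1 3 8 5)) (blue 1 3 8 4))) (split 1 7 (split 1 4 (red 1 4 7) (split
  0 4 (split 1 3 (split 1 5 (split 1 8 (split 1 9 (split 3 7 (red 1 3 7) (split 3 9 (red 1 3 9)
  (blue 0 7 3 9))) (blue 0 6 1 9)) (blue 1 6 4 8)) (blue 1 4 8 5)) (blue 1 3 8 4)) (blue 0 4 1 6)))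
  (blue 0 6 1 7))) (blue 4 6 5 8)) (blue 0 6 4 9)) (blue 0 6 4 7)) (blue 3 6 4 8))))))) (split 0 9
  (split 3 9 (red 0 3 9) (split 4 9 (split 0 4 (red 0 4 9) (split 1 4 (split 1 9 (red 1 4 9) (split
  2 4 (split 2 9 (red 2 4 9) (split 1 6 (split 4 6 (red 1 4 6) (split 4 7 (split 1 7 (red 1 4 7)
  (split 1 8 (split 2 7 (red 2 4 7) (blue 1 7 2 9)) (blue 0 7 1 8))) (blue 0 6 4 7))) (split 1 7
  (split 1 8 (split 2 6 (split 3 6 (split 2 3 (red 2 3 6) (split 1 3 (split 3 7 (red 1 3 7) (split
  2 7 (split 3 8 (red 1 3 8) (blue 0 7 3 8)) (blue 2 7 3 9))) (blue 1 3 2 9))) (blue 1 6 3 9))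
  (blue 1 6 2 9)) (blue 0 6 1 8)) (blue 0 6 1 7)))) (split 2 6 (split 2 7 (split 2 8 (split 2 5
  (split 5 6 (red 2 5 6) (split 5 7 (red 2 5 7) (blue 0 6 5 7))) (split 0 5 (split 5 9 (red 0 5 9)
  (split 2 3 (split 3 6 (red 2 3 6) (split 1 6 (split 3 7 (red 2 3 7) (blue 0 6 3 7)) (blue 1 6 3
  9))) (blue 2 3 9 5))) (blue 0 4 2 5))) (blue 0 4 2 8)) (blue 0 4 2 7)) (blue 0 4 2 6)))) (split 1
  6 (split 1 7 (split 1 8 (split 1 5 (split 5 6 (red 1 5 6) (split 5 7 (red 1 5 7) (blue 0 6 5 7)))
  (split 0 5 (split 5 9 (red 0 5 9) (split 1 3 (split 3 6 (red 1 3 6) (split 3 7 (red 1 3 7) (blue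
  0 6 3 7))) (blue 1 3 9 5))) (blue 0 4 1 5))) (blue 0 4 1 8)) (blue 0 4 1 7)) (blue 0 4 1 6))))
  (split 5 9 (split 0 5 (red 0 5 9) (split 1 5 (split 1 9 (red 1 5 9) (split 1 6 (split 5 6 (red 1
  5 6) (split 5 7 (split 1 7 (red 1 5 7) (split 1 8 (split 3 7 (split 4 7 (split 5 8 (red 1 5 8)
  (blue 0 6 5 8)) (blue 1 7 4 9)) (blue 1 7 3 9)) (blue 0 7 1 8))) (blue 0 6 5 7))) (split 1 7
  (split 1 8 (split 3 6 (split 4 6 (split 5 7 (red 1 5 7) (split 5 6 (split 5 8 (red 1 5 8) (blue 0
  7 5 8)) (blue 0 6 5 7))) (blue 1 6 4 9)) (blue 1 6 3 9)) (blue 0 6 1 8)) (blue 0 6 1 7)))) (split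
  1 6 (split 1 7 (split 1 8 (split 1 4 (split 4 6 (red 1 4 6) (split 3 6 (split 1 3 (red 1 3 6)
  (split 4 7 (red 1 4 7) (blue 0 6 4 7))) (blue 3 6 4 9))) (split 0 4 (split 1 3 (split 3 6 (red 1
  3 6) (split 3 7 (red 1 3 7) (blue 0 6 3 7))) (blue 1 3 9 4)) (blue 0 4 1 5))) (blue 0 5 1 8))
  (blue 0 5 1 7)) (blue 0 5 1 6)))) (split 4 6 (split 1 6 (split 1 4 (red 1 4 6) (split 1 3 (split
  1 5 (split 3 6 (red 1 3 6) (split 3 7 (split 1 7 (red 1 3 7) (split 0 4 (split 1 8 (split 3 8
  (red 1 3 8) (blue 0 6 3 8)) (blue 0 7 1 8)) (blue 0 4 1 7))) (blue 0 6 3 7))) (blue 1 4 9 5))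
  (blue 1 3 9 4))) (split 1 7 (split 1 8 (split 1 5 (split 5 7 (red 1 5 7) (split 3 7 (split 1 3
  (red 1 3 7) (split 1 4 (split 4 7 (red 1 4 7) (blue 4 7 5 9)) (blue 1 3 9 4))) (blue 3 7 5 9)))
  (split 0 5 (split 1 3 (split 1 4 (split 3 7 (red 1 3 7) (split 3 6 (split 3 8 (red 1 3 8) (blue 0
  7 3 8)) (blue 0 6 3 7))) (blue 1 4 9 5)) (blue 1 3 9 5)) (blue 0 5 1 6))) (blue 0 6 1 8)) (blue 0
  6 1 7))) (split 3 6 (split 4 7 (split 4 8 (split 5 6 (split 1 6 (split 1 3 (red 1 3 6) (split 1 4
  (split 1 5 (red 1 5 6) (blue 1 3 9 5)) (blue 1 3 9 4))) (split 1 7 (split 1 4 (red 1 4 7) (split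
  0 4 (split 1 3 (split 1 5 (split 1 8 (split 1 9 (split 3 7 (red 1 3 7) (split 3 8 (red 1 3 8)
  (blue 0 7 3 8))) (blue 1 6 4 9)) (blue 0 6 1 8)) (blue 1 4 9 5)) (blue 1 3 9 4)) (blue 0 4 1 6)))
  (blue 0 6 1 7))) (blue 4 6 5 9)) (blue 0 6 4 8)) (blue 0 6 4 7)) (blue 3 6 4 9)))))) (split 1 6
  (split 4 6 (split 1 4 (red 1 4 6) (split 2 6 (split 2 4 (red 2 4 6) (split 3 6 (split 1 3 (red 1
  3 6) (split 2 3 (red 2 3 6) (blue 1 3 2 4))) (split 3 7 (split 3 8 (split 3 9 (split 5 6 (split 1
  5 (red 1 5 6) (split 2 5 (red 2 5 6) (blue 1 4 2 5))) (split 5 7 (split 5 8 (split 5 9 (split 1 7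
  (split 1 3 (red 1 3 7) (split 1 5 (red 1 5 7) (blue 1 3 6 5))) (split 0 4 (split 1 8 (split 1 3
  (red 1 3 8) (split 1 5 (red 1 5 8) (blue 1 3 6 5))) (blue 0 7 1 8)) (blue 0 4 1 7))) (blue 0 6 5
  9)) (blue 0 6 5 8)) (blue 0 6 5 7))) (blue 0 6 3 9)) (blue 0 6 3 8)) (blue 0 6 3 7)))) (split 2 7
  (split 2 8 (split 2 9 (split 2 4 (split 4 7 (red 2 4 7) (split 4 8 (red 2 4 8) (blue 0 7 4 8)))
  (split 0 4 (split 2 5 (split 5 7 (red 2 5 7) (split 5 6 (split 1 5 (red 1 5 6) (split 4 7 (split
  5 8 (red 2 5 8) (blue 0 7 5 8)) (blue 1 4 7 5))) (blue 0 6 5 7))) (split 0 5 (split 1 5 (split 5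
  6 (red 1 5 6) (split 5 7 (split 1 7 (red 1 5 7) (split 1 8 (split 1 9 (split 5 8 (red 1 5 8)
  (blue 0 6 5 8)) (blue 0 7 1 9)) (blue 0 7 1 8))) (blue 0 6 5 7))) (blue 1 4 2 5)) (blue 0 5 2
  6))) (blue 0 4 2 6))) (blue 0 6 2 9)) (blue 0 6 2 8)) (blue 0 6 2 7)))) (split 4 7 (split 4 8
  (split 4 9 (split 2 7 (split 2 4 (red 2 4 7) (split 5 6 (split 1 5 (red 1 5 6) (split 1 4 (split
  1 7 (red 1 4 7) (split 0 5 (split 1 8 (red 1 4 8) (blue 0 7 1 8)) (blue 0 5 1 7))) (split 2 5
  (split 2 6 (red 2 5 6) (split 0 4 (split 2 8 (split 2 9 (split 5 7 (red 2 5 7) (split 5 8 (red 2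
  5 8) (blue 0 7 5 8))) (blue 0 6 2 9)) (blue 0 6 2 8)) (blue 0 4 2 6))) (blue 1 4 2 5)))) (split 2
  5 (split 5 7 (red 2 5 7) (blue 0 6 5 7)) (blue 2 4 6 5)))) (split 2 6 (split 2 8 (split 2 4 (red
  2 4 8) (split 0 4 (split 2 9 (split 3 6 (split 1 3 (red 1 3 6) (split 2 3 (red 2 3 6) (split 1 4
  (split 1 7 (red 1 4 7) (blue 1 3 2 7)) (blue 1 3 2 4)))) (split 2 3 (split 3 7 (split 3 8 (red 2
  3 8) (blue 0 6 3 8)) (blue 0 6 3 7)) (blue 2 3 6 4))) (blue 0 7 2 9)) (blue 0 4 2 7))) (blue 0 7
  2 8)) (blue 0 6 2 7))) (blue 0 6 4 9)) (blue 0 6 4 8)) (blue 0 6 4 7))) (split 1 7 (split 1 8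
  (split 1 9 (split 1 4 (split 4 7 (red 1 4 7) (split 4 6 (split 4 8 (red 1 4 8) (blue 0 7 4 8))
  (blue 0 6 4 7))) (split 0 4 (split 1 5 (split 5 7 (red 1 5 7) (split 5 6 (split 5 8 (red 1 5 8)
  (blue 0 7 5 8)) (blue 0 6 5 7))) (split 0 5 (split 1 3 (split 3 7 (red 1 3 7) (split 3 6 (split 3
  8 (red 1 3 8) (blue 0 7 3 8)) (blue 0 6 3 7))) (split 2 6 (split 3 6 (split 2 3 (red 2 3 6)
  (split 2 4 (split 2 5 (split 4 6 (red 2 4 6) (split 4 7 (split 2 7 (red 2 4 7) (split 2 8 (split
  2 9 (split 4 8 (red 2 4 8) (blue 0 6 4 8)) (blue 0 7 2 9)) (blue 0 7 2 8))) (blue 0 6 4 7)))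
  (blue 1 3 2 5)) (blue 1 3 2 4))) (split 3 7 (split 3 8 (split 3 9 (split 4 6 (split 2 4 (red 2 4
  6) (split 2 3 (split 2 5 (split 2 7 (red 2 3 7) (split 2 8 (red 2 3 8) (blue 0 7 2 8))) (blue 1 4
  2 5)) (blue 1 3 2 4))) (blue 1 3 6 4)) (blue 0 6 3 9)) (blue 0 6 3 8)) (blue 0 6 3 7))) (split 2
  3 (split 2 4 (split 2 5 (split 2 7 (split 2 8 (split 2 9 (split 3 7 (red 2 3 7) (split 3 6 (split
  3 8 (red 2 3 8) (blue 0 7 3 8)) (blue 0 6 3 7))) (blue 0 6 2 9)) (blue 0 6 2 8)) (blue 0 6 2 7))
  (blue 1 5 2 6)) (blue 1 4 2 6)) (blue 1 3 2 6)))) (blue 0 5 1 6))) (blue 0 4 1 6))) (blue 0 6 1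
  9)) (blue 0 6 1 8)) (blue 0 6 1 7))))))) (split 0 4 (split 0 6 (split 4 6 (red 0 4 6) (split 0 5
  (split 5 6 (red 0 5 6) (split 4 7 (split 0 7 (red 0 4 7) (split 5 8 (split 0 8 (red 0 5 8) (split
  1 7 (split 1 4 (red 1 4 7) (split 1 5 (split 1 8 (red 1 5 8) (split 1 3 (split 3 7 (red 1 3 7)
  (split 3 8 (split 5 7 (red 1 5 7) (split 3 6 (split 1 6 (red 1 3 6) (split 4 8 (split 2 8 (split
  2 3 (red 2 3 8) (split 2 4 (red 2 4 8) (split 2 5 (red 2 5 8) (blue 2 3 7 5)))) (split 2 3 (split
  2 4 (split 2 6 (red 2 3 6) (blue 1 6 2 8)) (blue 1 4 2 8)) (blue 0 3 2 8))) (blue 1 6 4 8)))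
  (blue 3 6 5 7))) (blue 0 7 3 8))) (blue 0 3 1 8))) (blue 1 4 6 5))) (split 1 3 (split 1 8 (split
  1 5 (red 1 5 8) (split 1 4 (split 3 8 (red 1 3 8) (split 3 7 (split 4 8 (red 1 4 8) (split 3 6
  (split 1 6 (red 1 3 6) (split 5 7 (split 2 7 (split 2 3 (red 2 3 7) (split 2 4 (red 2 4 7) (blue
  2 3 8 4))) (split 2 3 (split 2 5 (split 2 6 (red 2 3 6) (blue 1 6 2 7)) (blue 1 5 2 7)) (blue 0 3
  2 7))) (blue 1 6 5 7))) (blue 3 6 4 8))) (blue 0 7 3 8))) (blue 1 4 6 5))) (blue 0 7 1 8)) (blue
  0 3 1 7)))) (split 4 8 (split 0 8 (red 0 4 8) (split 5 7 (split 1 7 (split 1 4 (red 1 4 7) (split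
  1 5 (red 1 5 7) (blue 1 4 6 5))) (split 1 3 (split 1 8 (split 1 4 (red 1 4 8) (split 1 5 (split 3
  8 (red 1 3 8) (split 3 6 (split 1 6 (red 1 3 6) (split 3 7 (split 2 7 (split 2 3 (red 2 3 7)
  (split 2 4 (red 2 4 7) (split 2 5 (red 2 5 7) (blue 2 3 8 5)))) (split 2 3 (split 2 4 (split 2 6
  (red 2 3 6) (blue 1 6 2 7)) (blue 1 4 2 7)) (blue 0 3 2 7))) (blue 0 7 3 8))) (blue 3 6 5 8)))
  (blue 1 4 6 5))) (blue 0 7 1 8)) (blue 0 3 1 7))) (blue 0 7 5 8))) (blue 4 6 5 8)))) (split 5 7
  (split 0 7 (red 0 5 7) (split 4 8 (split 0 8 (red 0 4 8) (split 0 9 (split 4 9 (red 0 4 9) (split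
  5 9 (red 0 5 9) (blue 4 6 5 9))) (split 4 9 (split 1 7 (split 1 5 (red 1 5 7) (split 1 4 (split 1
  8 (red 1 4 8) (split 1 3 (split 1 9 (red 1 4 9) (blue 0 8 1 9)) (blue 0 3 1 8))) (blue 1 4 6 5)))
  (split 1 3 (split 1 6 (split 1 8 (split 1 4 (red 1 4 8) (split 1 5 (split 1 9 (split 3 6 (red 1 3
  6) (split 3 7 (split 3 8 (red 1 3 8) (split 3 9 (red 1 3 9) (blue 0 8 3 9))) (blue 3 6 4 7)))
  (blue 0 7 1 9)) (blue 1 4 6 5))) (blue 0 7 1 8)) (blue 1 6 4 7)) (blue 0 3 1 7))) (blue 0 7 4
  9)))) (split 0 8 (split 5 8 (red 0 5 8) (blue 4 6 5 8)) (blue 0 7 4 8)))) (blue 4 6 5 7))))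
  (split 4 7 (split 0 7 (red 0 4 7) (split 1 7 (split 1 4 (red 1 4 7) (split 1 3 (split 3 7 (red 1
  3 7) (split 5 7 (split 1 5 (red 1 5 7) (split 5 6 (split 2 5 (split 2 6 (red 2 5 6) (split 2 7
  (red 2 5 7) (split 2 3 (split 3 6 (split 1 6 (red 1 3 6) (split 2 4 (split 2 8 (split 3 8 (red 2
  3 8) (split 0 8 (split 4 8 (red 0 4 8) (split 1 8 (split 5 8 (red 2 5 8) (blue 1 4 8 5)) (blue 1
  6 4 8))) (blue 0 7 3 8))) (split 0 8 (split 1 8 (split 3 8 (red 1 3 8) (blue 2 7 3 8)) (blue 1 6
  2 8)) (blue 0 7 2 8))) (blue 1 4 2 6))) (blue 2 6 3 7)) (blue 0 3 2 7)))) (split 2 3 (split 2 4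
  (split 2 7 (red 2 4 7) (blue 0 5 2 7)) (blue 1 4 2 5)) (blue 0 3 2 5))) (blue 1 4 6 5))) (blue 0
  3 7 5))) (split 1 5 (split 3 6 (split 5 7 (red 1 5 7) (split 3 7 (split 2 3 (split 2 6 (red 2 3
  6) (split 2 7 (red 2 3 7) (split 2 5 (split 5 6 (split 1 6 (red 1 5 6) (split 2 4 (split 2 8
  (split 3 8 (red 2 3 8) (split 4 8 (red 2 4 8) (blue 1 3 8 4))) (split 0 8 (split 1 8 (split 4 8
  (red 0 4 8) (blue 2 6 4 8)) (blue 1 6 2 8)) (blue 0 7 2 8))) (blue 1 4 2 6))) (blue 2 6 5 7))
  (blue 0 5 2 7)))) (split 2 4 (split 2 5 (split 2 7 (red 2 4 7) (blue 0 3 2 7)) (blue 0 3 2 5))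
  (blue 1 3 2 4))) (blue 0 3 7 5))) (blue 1 3 6 4)) (blue 0 3 1 5)))) (split 1 3 (split 1 5 (split
  2 7 (split 2 4 (red 2 4 7) (split 2 3 (split 3 7 (red 2 3 7) (split 5 7 (split 2 5 (red 2 5 7)
  (split 5 6 (split 1 6 (red 1 5 6) (split 3 6 (split 2 6 (red 2 3 6) (split 1 4 (split 1 8 (split
  3 8 (red 1 3 8) (split 0 8 (split 4 8 (red 0 4 8) (split 2 8 (split 5 8 (red 1 5 8) (blue 2 4 8
  5)) (blue 2 6 4 8))) (blue 0 7 3 8))) (split 0 8 (split 2 8 (split 3 8 (red 2 3 8) (blue 1 7 3
  8)) (blue 1 6 2 8)) (blue 0 7 1 8))) (blue 1 4 2 6))) (blue 1 6 3 7))) (blue 2 4 6 5))) (blue 0 3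
  7 5))) (split 2 5 (split 3 6 (split 1 6 (red 1 3 6) (split 5 7 (red 2 5 7) (split 3 7 (split 5 6
  (split 2 6 (red 2 5 6) (split 1 4 (split 1 8 (split 3 8 (red 1 3 8) (split 4 8 (red 1 4 8) (blue
  2 3 8 4))) (split 0 8 (split 2 8 (split 4 8 (red 0 4 8) (blue 1 6 4 8)) (blue 1 6 2 8)) (blue 0 7
  1 8))) (blue 1 4 2 6))) (blue 1 6 5 7)) (blue 0 3 7 5)))) (blue 2 3 6 4)) (blue 0 3 2 5))))
  (split 2 3 (split 2 5 (split 1 8 (split 3 8 (red 1 3 8) (split 5 8 (red 1 5 8) (blue 0 3 8 5)))
  (split 0 8 (split 2 8 (split 3 8 (red 2 3 8) (split 3 7 (split 4 8 (red 0 4 8) (split 1 6 (split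
  3 6 (red 1 3 6) (blue 3 6 4 8)) (blue 1 6 4 8))) (blue 1 7 3 8))) (blue 1 7 2 8)) (blue 0 7 1
  8))) (blue 0 5 2 7)) (blue 0 3 2 7))) (blue 0 5 1 7)) (blue 0 3 1 7)))) (split 4 8 (split 0 8
  (red 0 4 8) (split 1 8 (split 1 4 (red 1 4 8) (split 1 3 (split 3 8 (red 1 3 8) (split 5 8 (split
  1 5 (red 1 5 8) (split 5 6 (split 5 7 (split 2 5 (split 2 6 (red 2 5 6) (split 2 7 (red 2 5 7)
  (blue 2 6 4 7))) (split 2 3 (split 2 4 (split 2 8 (red 2 4 8) (blue 0 5 2 8)) (blue 1 4 2 5))
  (blue 0 3 2 5))) (blue 1 4 7 5)) (blue 1 4 6 5))) (blue 0 3 8 5))) (split 1 5 (split 3 6 (split 3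
  7 (split 5 8 (red 1 5 8) (split 3 8 (split 2 3 (split 2 6 (red 2 3 6) (split 2 7 (red 2 3 7)
  (blue 2 6 4 7))) (split 2 4 (split 2 5 (split 2 8 (red 2 4 8) (blue 0 3 2 8)) (blue 0 3 2 5))
  (blue 1 3 2 4))) (blue 0 3 8 5))) (blue 1 3 7 4)) (blue 1 3 6 4)) (blue 0 3 1 5)))) (split 1 3
  (split 1 5 (split 1 7 (split 3 7 (red 1 3 7) (split 3 6 (split 1 6 (red 1 3 6) (split 5 7 (red 1
  5 7) (blue 0 3 7 5))) (blue 3 6 4 7))) (split 0 7 (split 1 6 (split 3 6 (red 1 3 6) (split 3 7
  (split 5 6 (red 1 5 6) (blue 0 3 6 5)) (blue 3 6 4 7))) (blue 1 6 4 7)) (blue 0 7 1 8))) (blue 0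
  5 1 8)) (blue 0 3 1 8)))) (split 4 9 (split 0 9 (red 0 4 9) (split 1 9 (split 1 4 (red 1 4 9)
  (split 1 3 (split 3 9 (red 1 3 9) (split 5 9 (split 1 5 (red 1 5 9) (split 5 6 (split 5 7 (split
  5 8 (split 2 5 (split 2 6 (red 2 5 6) (split 2 7 (red 2 5 7) (blue 2 6 4 7))) (split 2 3 (split 2
  4 (split 2 9 (red 2 4 9) (blue 0 5 2 9)) (blue 1 4 2 5)) (blue 0 3 2 5))) (blue 1 4 8 5)) (blue 1
  4 7 5)) (blue 1 4 6 5))) (blue 0 3 9 5))) (split 1 5 (split 3 6 (split 3 7 (split 3 8 (split 5 9
  (red 1 5 9) (split 3 9 (split 2 3 (split 2 6 (red 2 3 6) (split 2 7 (red 2 3 7) (blue 2 6 4 7)))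
  (split 2 4 (split 2 5 (split 2 9 (red 2 4 9) (blue 0 3 2 9)) (blue 0 3 2 5)) (blue 1 3 2 4)))
  (blue 0 3 9 5))) (blue 1 3 8 4)) (blue 1 3 7 4)) (blue 1 3 6 4)) (blue 0 3 1 5)))) (split 1 3
  (split 1 5 (split 1 7 (split 3 7 (red 1 3 7) (split 3 6 (split 1 6 (red 1 3 6) (split 1 8 (split
  3 8 (red 1 3 8) (blue 3 7 4 8)) (blue 1 6 4 8))) (blue 3 6 4 7))) (split 0 7 (split 1 6 (split 1
  8 (split 3 6 (red 1 3 6) (split 3 7 (split 3 8 (red 1 3 8) (blue 3 6 4 8)) (blue 3 6 4 7))) (blue
  1 7 4 8)) (blue 1 6 4 7)) (blue 0 7 1 9))) (blue 0 5 1 9)) (blue 0 3 1 9)))) (split 3 7 (split 1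
  7 (split 1 3 (red 1 3 7) (split 1 5 (split 5 7 (red 1 5 7) (split 5 6 (split 1 6 (red 1 5 6)
  (split 1 8 (split 1 9 (split 5 8 (red 1 5 8) (blue 4 7 5 8)) (blue 1 6 4 9)) (blue 1 6 4 8)))
  (blue 4 6 5 7))) (blue 0 3 1 5))) (split 1 6 (split 1 8 (split 1 9 (split 1 5 (split 5 6 (red 1 5
  6) (split 3 6 (split 1 3 (red 1 3 6) (split 0 7 (split 5 7 (split 5 8 (red 1 5 8) (blue 4 6 5 8))
  (blue 4 6 5 7)) (blue 0 3 1 7))) (blue 0 3 6 5))) (split 0 7 (split 1 3 (split 3 6 (red 1 3 6)
  (split 3 8 (red 1 3 8) (blue 3 6 4 8))) (blue 0 3 1 5)) (blue 0 5 1 7))) (blue 1 7 4 9)) (blue 1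
  7 4 8)) (blue 1 6 4 7))) (split 3 6 (split 3 8 (split 3 9 (split 5 7 (split 1 3 (split 1 6 (red 1
  3 6) (split 1 7 (split 1 5 (red 1 5 7) (split 1 8 (red 1 3 8) (blue 1 6 4 8))) (blue 1 6 4 7)))
  (split 1 4 (split 1 5 (split 1 7 (red 1 5 7) (split 0 7 (split 1 6 (split 1 8 (split 1 9 (split 5
  6 (red 1 5 6) (split 5 8 (red 1 5 8) (blue 4 6 5 8))) (blue 1 7 4 9)) (blue 1 7 4 8)) (blue 1 6 4
  7)) (blue 0 3 1 7))) (blue 0 3 1 5)) (blue 1 3 7 4))) (blue 0 3 7 5)) (blue 3 7 4 9)) (blue 3 7 4
  8)) (blue 3 6 4 7)))))))) (split 0 7 (split 4 7 (red 0 4 7) (split 0 5 (split 5 7 (red 0 5 7)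
  (split 4 8 (split 0 8 (red 0 4 8) (split 1 8 (split 1 4 (red 1 4 8) (split 1 5 (split 5 8 (red 1
  5 8) (split 5 6 (split 1 6 (red 1 5 6) (split 1 3 (split 3 8 (red 1 3 8) (split 3 6 (split 3 7
  (split 1 7 (red 1 3 7) (split 4 6 (split 2 6 (split 2 3 (red 2 3 6) (split 2 4 (red 2 4 6) (split
  2 5 (red 2 5 6) (blue 2 3 8 5)))) (split 2 3 (split 2 4 (split 2 7 (red 2 3 7) (blue 1 6 2 7))
  (blue 1 4 2 6)) (blue 0 3 2 6))) (blue 1 6 4 7))) (blue 3 7 5 8)) (blue 0 6 3 8))) (blue 0 3 1
  6))) (blue 0 6 5 8))) (blue 1 4 7 5))) (split 1 3 (split 1 6 (split 3 6 (red 1 3 6) (split 3 8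
  (split 2 8 (split 2 3 (red 2 3 8) (split 2 4 (red 2 4 8) (split 2 5 (split 2 6 (split 3 7 (split
  1 7 (red 1 3 7) (split 4 6 (split 1 4 (red 1 4 6) (split 1 5 (split 2 7 (split 5 6 (red 1 5 6)
  (split 5 8 (red 2 5 8) (blue 0 6 5 8))) (blue 1 4 2 7)) (blue 1 4 7 5))) (blue 2 3 6 4))) (blue 2
  3 7 4)) (blue 0 3 2 6)) (blue 2 4 7 5)))) (split 2 3 (split 2 6 (split 0 9 (split 4 9 (red 0 4 9)
  (split 5 9 (red 0 5 9) (blue 4 7 5 9))) (split 1 9 (split 2 9 (split 3 9 (red 1 3 9) (blue 0 6 3
  9)) (blue 0 8 2 9)) (blue 0 8 1 9))) (blue 0 6 2 8)) (blue 0 3 2 8))) (blue 0 6 3 8))) (blue 0 6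
  1 8)) (blue 0 3 1 8)))) (split 5 8 (split 0 8 (red 0 5 8) (split 4 6 (split 0 9 (split 4 9 (red 0
  4 9) (split 5 9 (red 0 5 9) (blue 4 7 5 9))) (split 4 9 (split 1 8 (split 1 5 (red 1 5 8) (split
  1 4 (split 1 6 (red 1 4 6) (split 1 3 (split 1 9 (red 1 4 9) (blue 0 6 1 9)) (blue 0 3 1 6)))
  (blue 1 4 7 5))) (split 1 3 (split 1 6 (split 1 4 (red 1 4 6) (split 1 5 (split 1 7 (split 1 9
  (split 3 6 (red 1 3 6) (split 3 7 (red 1 3 7) (split 3 8 (split 3 9 (red 1 3 9) (blue 0 6 3 9))
  (blue 0 6 3 8)))) (blue 0 8 1 9)) (blue 1 7 4 8)) (blue 1 4 7 5))) (blue 0 6 1 8)) (blue 0 3 1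
  8))) (blue 0 8 4 9))) (blue 0 6 4 8))) (blue 4 7 5 8)))) (split 1 3 (split 1 6 (split 3 6 (red 1
  3 6) (split 5 6 (split 1 5 (red 1 5 6) (split 2 5 (split 2 6 (red 2 5 6) (split 2 3 (split 3 8
  (split 1 8 (red 1 3 8) (split 0 8 (split 2 8 (red 2 3 8) (split 4 8 (red 0 4 8) (split 1 7 (split
  2 7 (split 3 7 (red 1 3 7) (split 4 6 (split 1 4 (red 1 4 6) (split 2 4 (split 5 7 (red 2 5 7)
  (blue 1 4 7 5)) (blue 1 4 2 8))) (blue 2 6 4 8))) (blue 2 7 4 8)) (blue 1 7 4 8)))) (blue 0 5 1
  8))) (split 0 8 (split 2 8 (split 4 8 (red 0 4 8) (split 3 7 (split 1 7 (red 1 3 7) (split 1 8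
  (split 2 7 (red 2 3 7) (split 4 6 (split 1 4 (red 1 4 6) (split 2 4 (split 5 7 (split 5 8 (red 2
  5 8) (blue 1 4 8 5)) (blue 1 4 7 5)) (blue 1 4 2 7))) (blue 2 6 4 7))) (blue 1 7 4 8))) (blue 3 7
  4 8))) (blue 2 6 3 8)) (blue 0 6 3 8))) (blue 0 3 2 6))) (split 2 3 (split 2 6 (split 3 8 (split
  1 8 (red 1 3 8) (split 0 8 (split 2 8 (red 2 3 8) (blue 1 5 2 8)) (blue 0 5 1 8))) (split 0 8
  (split 4 8 (red 0 4 8) (split 3 7 (split 1 7 (red 1 3 7) (split 1 8 (split 2 7 (red 2 3 7) (blue
  1 5 2 7)) (blue 1 7 4 8))) (blue 3 7 4 8))) (blue 0 6 3 8))) (blue 0 5 2 6)) (blue 0 3 2 5))))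
  (blue 0 3 6 5))) (split 1 5 (split 1 8 (split 3 8 (red 1 3 8) (split 5 8 (red 1 5 8) (blue 0 3 8
  5))) (split 0 8 (split 4 8 (red 0 4 8) (split 1 7 (split 3 7 (red 1 3 7) (split 3 8 (split 4 6
  (split 5 7 (red 1 5 7) (blue 0 3 7 5)) (blue 1 6 4 8)) (blue 3 7 4 8))) (blue 1 7 4 8))) (blue 0
  6 1 8))) (blue 0 5 1 6))) (split 1 5 (split 1 6 (split 5 6 (red 1 5 6) (split 3 6 (split 2 3
  (split 2 6 (red 2 3 6) (split 2 5 (split 5 8 (split 1 8 (red 1 5 8) (split 0 8 (split 2 8 (red 2
  5 8) (split 4 8 (red 0 4 8) (split 1 7 (split 2 7 (split 3 7 (red 2 3 7) (split 1 4 (split 3 8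
  (split 4 6 (red 1 4 6) (blue 2 6 4 8)) (blue 3 7 4 8)) (blue 1 3 7 4))) (blue 2 7 4 8)) (blue 1 7
  4 8)))) (blue 0 3 1 8))) (split 0 8 (split 2 8 (split 3 8 (red 2 3 8) (blue 0 3 8 5)) (blue 2 6 5
  8)) (blue 0 6 5 8))) (blue 0 5 2 6))) (split 2 5 (split 2 6 (split 5 8 (split 1 8 (red 1 5 8)
  (split 0 8 (split 2 8 (red 2 5 8) (blue 1 3 2 8)) (blue 0 3 1 8))) (split 0 8 (split 3 8 (split 4
  8 (red 0 4 8) (split 4 6 (split 1 4 (red 1 4 6) (split 2 4 (red 2 4 6) (blue 1 3 2 4))) (blue 4 6
  5 8))) (blue 0 3 8 5)) (blue 0 6 5 8))) (blue 0 3 2 6)) (blue 0 3 2 5))) (blue 0 3 6 5))) (blue 0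
  3 1 6)) (blue 0 3 1 5))))) (split 0 8 (split 4 8 (red 0 4 8) (split 0 9 (split 4 9 (red 0 4 9)
  (split 0 5 (split 5 8 (red 0 5 8) (split 5 9 (red 0 5 9) (blue 4 8 5 9))) (split 1 3 (split 1 6
  (split 3 6 (red 1 3 6) (split 3 7 (split 1 7 (red 1 3 7) (split 1 5 (split 5 6 (red 1 5 6) (blue
  0 3 6 5)) (blue 0 5 1 7))) (blue 0 6 3 7))) (split 1 5 (split 1 7 (split 3 7 (red 1 3 7) (split 3
  6 (split 5 7 (red 1 5 7) (blue 0 3 7 5)) (blue 0 6 3 7))) (blue 0 6 1 7)) (blue 0 5 1 6))) (split
  1 5 (split 1 6 (split 1 7 (split 5 6 (red 1 5 6) (split 3 6 (split 5 7 (red 1 5 7) (blue 0 6 5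
  7)) (blue 0 3 6 5))) (blue 0 3 1 7)) (blue 0 3 1 6)) (blue 0 3 1 5))))) (split 1 3 (split 1 6
  (split 3 6 (red 1 3 6) (split 3 7 (split 1 7 (red 1 3 7) (split 1 9 (split 3 9 (red 1 3 9) (blue
  0 6 3 9)) (blue 0 7 1 9))) (blue 0 6 3 7))) (split 1 7 (split 1 9 (split 3 7 (red 1 3 7) (split 3
  6 (split 3 9 (red 1 3 9) (blue 0 7 3 9)) (blue 0 6 3 7))) (blue 0 6 1 9)) (blue 0 6 1 7))) (split
  1 6 (split 1 7 (split 1 9 (split 1 5 (split 5 6 (red 1 5 6) (split 5 7 (red 1 5 7) (blue 0 6 5
  7))) (split 0 5 (split 5 8 (red 0 5 8) (split 1 4 (split 3 8 (split 4 6 (red 1 4 6) (split 4 7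
  (red 1 4 7) (blue 0 6 4 7))) (blue 1 3 8 5)) (blue 1 4 8 5))) (blue 0 3 1 5))) (blue 0 3 1 9))
  (blue 0 3 1 7)) (blue 0 3 1 6))))) (split 0 9 (split 4 9 (red 0 4 9) (split 1 3 (split 1 6 (split
  3 6 (red 1 3 6) (split 3 7 (split 1 7 (red 1 3 7) (split 1 8 (split 3 8 (red 1 3 8) (blue 0 6 3
  8)) (blue 0 7 1 8))) (blue 0 6 3 7))) (split 1 7 (split 1 8 (split 3 7 (red 1 3 7) (split 3 6
  (split 3 8 (red 1 3 8) (blue 0 7 3 8)) (blue 0 6 3 7))) (blue 0 6 1 8)) (blue 0 6 1 7))) (split 1
  6 (split 1 7 (split 1 8 (split 1 5 (split 5 6 (red 1 5 6) (split 5 7 (red 1 5 7) (blue 0 6 5 7)))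
  (split 0 5 (split 5 9 (red 0 5 9) (split 1 4 (split 3 9 (split 4 6 (red 1 4 6) (split 4 7 (red 1
  4 7) (blue 0 6 4 7))) (blue 1 3 9 5)) (blue 1 4 9 5))) (blue 0 3 1 5))) (blue 0 3 1 8)) (blue 0 3
  1 7)) (blue 0 3 1 6)))) (split 1 3 (split 1 6 (split 3 6 (red 1 3 6) (split 3 7 (split 1 7 (red 1
  3 7) (split 1 8 (split 1 9 (split 3 8 (red 1 3 8) (blue 0 6 3 8)) (blue 0 7 1 9)) (blue 0 7 1
  8))) (blue 0 6 3 7))) (split 1 7 (split 1 8 (split 1 9 (split 3 7 (red 1 3 7) (split 3 6 (split 3
  8 (red 1 3 8) (blue 0 7 3 8)) (blue 0 6 3 7))) (blue 0 6 1 9)) (blue 0 6 1 8)) (blue 0 6 1 7)))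
  (split 1 6 (split 1 7 (split 1 8 (split 1 9 (split 1 5 (split 5 6 (red 1 5 6) (split 5 7 (red 1 5
  7) (blue 0 6 5 7))) (split 0 5 (split 1 4 (split 4 6 (red 1 4 6) (split 4 7 (red 1 4 7) (blue 0 6
  4 7))) (split 2 3 (split 3 6 (split 2 6 (red 2 3 6) (split 2 7 (split 2 8 (split 2 9 (split 3 7
  (red 2 3 7) (split 3 8 (red 2 3 8) (blue 0 7 3 8))) (blue 0 6 2 9)) (blue 0 6 2 8)) (blue 0 6 2
  7))) (split 3 7 (split 2 7 (red 2 3 7) (split 2 6 (split 2 8 (split 2 9 (split 3 8 (red 2 3 8)
  (blue 0 6 3 8)) (blue 0 7 2 9)) (blue 0 7 2 8)) (blue 0 6 2 7))) (blue 0 6 3 7))) (split 2 4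
  (split 2 5 (split 2 6 (split 2 7 (split 2 8 (split 2 9 (split 4 6 (red 2 4 6) (split 3 6 (split 4
  7 (red 2 4 7) (blue 0 6 4 7)) (blue 1 3 6 4))) (blue 0 3 2 9)) (blue 0 3 2 8)) (blue 0 3 2 7))
  (blue 0 3 2 6)) (blue 1 3 2 5)) (blue 1 3 2 4)))) (blue 0 3 1 5))) (blue 0 3 1 9)) (blue 0 3 1
  8)) (blue 0 3 1 7)) (blue 0 3 1 6))))))) (split 1 3 (split 3 6 (split 1 6 (red 1 3 6) (split 2 3
  (split 2 6 (red 2 3 6) (split 3 7 (split 1 7 (red 1 3 7) (split 2 7 (red 2 3 7) (blue 1 6 2 7)))
  (split 4 7 (split 3 8 (split 1 8 (red 1 3 8) (split 2 8 (red 2 3 8) (blue 1 6 2 8))) (split 4 8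
  (split 1 4 (split 1 7 (red 1 4 7) (split 1 8 (red 1 4 8) (blue 1 7 3 8))) (split 0 6 (split 2 4
  (split 2 7 (red 2 4 7) (split 1 7 (split 2 8 (red 2 4 8) (blue 2 7 3 8)) (blue 1 6 2 7))) (blue 1
  4 2 6)) (blue 0 4 1 6))) (blue 0 3 8 4))) (blue 0 3 7 4)))) (split 2 4 (split 2 6 (split 4 6 (red
  2 4 6) (split 4 7 (split 2 7 (red 2 4 7) (split 0 7 (split 0 5 (split 5 7 (red 0 5 7) (split 1 7
  (split 1 4 (red 1 4 7) (split 0 6 (split 3 7 (red 1 3 7) (split 2 5 (split 5 6 (red 0 5 6) (split
  1 5 (split 5 8 (split 0 8 (red 0 5 8) (split 1 8 (red 1 5 8) (blue 0 4 1 8))) (split 1 8 (split 2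
  8 (split 3 8 (red 1 3 8) (blue 3 7 5 8)) (blue 2 7 5 8)) (blue 1 6 5 8))) (blue 1 4 6 5))) (blue
  2 3 7 5))) (blue 0 4 1 6))) (split 5 6 (split 0 6 (red 0 5 6) (split 1 4 (split 2 5 (red 2 5 6)
  (split 1 5 (split 3 7 (split 1 8 (split 3 8 (red 1 3 8) (split 4 8 (red 1 4 8) (blue 0 3 8 4)))
  (split 0 8 (split 2 8 (split 4 8 (red 2 4 8) (blue 1 6 4 8)) (blue 1 7 2 8)) (blue 0 6 1 8)))
  (blue 2 3 7 5)) (blue 1 5 2 7))) (blue 0 4 1 6))) (blue 1 6 5 7)))) (split 2 5 (split 5 6 (red 2
  5 6) (blue 0 4 6 5)) (blue 0 3 2 5))) (blue 0 3 2 7))) (split 1 7 (split 3 7 (red 1 3 7) (blue 0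
  3 7 4)) (blue 1 6 4 7)))) (split 0 6 (split 0 5 (split 5 6 (red 0 5 6) (split 2 7 (split 4 7 (red
  2 4 7) (split 3 7 (split 1 7 (red 1 3 7) (split 4 6 (split 5 7 (split 0 7 (red 0 5 7) (split 1 4
  (split 2 5 (red 2 5 7) (split 1 5 (split 1 8 (split 3 8 (red 1 3 8) (split 4 8 (red 1 4 8) (blue
  0 3 8 4))) (split 0 8 (split 2 8 (split 4 8 (red 2 4 8) (blue 1 7 4 8)) (blue 1 6 2 8)) (blue 0 7
  1 8))) (blue 1 5 2 6))) (blue 0 4 1 7))) (blue 1 6 5 7)) (blue 1 6 4 7))) (blue 0 3 7 4))) (split
  0 7 (split 1 7 (split 3 7 (red 1 3 7) (split 4 7 (split 1 4 (red 1 4 7) (split 5 7 (red 0 5 7)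
  (blue 2 6 5 7))) (blue 0 3 7 4))) (blue 1 6 2 7)) (blue 0 3 2 7)))) (split 2 5 (split 2 7 (split
  4 7 (red 2 4 7) (split 3 7 (split 1 7 (red 1 3 7) (split 4 6 (split 5 7 (red 2 5 7) (blue 0 4 7
  5)) (blue 1 6 4 7))) (blue 0 3 7 4))) (split 0 7 (split 1 7 (split 3 7 (red 1 3 7) (split 4 7
  (split 1 4 (red 1 4 7) (split 1 5 (split 5 7 (red 1 5 7) (blue 0 3 7 5)) (blue 0 4 1 5))) (blue 0
  3 7 4))) (blue 1 6 2 7)) (blue 0 3 2 7))) (blue 0 3 2 5))) (blue 0 3 2 6))) (blue 0 3 2 4))))
  (split 4 6 (split 2 4 (split 2 6 (red 2 4 6) (split 3 7 (split 1 7 (red 1 3 7) (split 2 7 (split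
  2 3 (red 2 3 7) (split 0 6 (split 4 7 (red 2 4 7) (split 0 5 (split 5 6 (red 0 5 6) (split 2 5
  (split 5 7 (red 2 5 7) (split 1 6 (split 1 4 (red 1 4 6) (split 0 7 (split 1 5 (split 5 8 (split
  0 8 (red 0 5 8) (split 1 8 (red 1 5 8) (blue 0 4 1 8))) (split 1 8 (split 2 8 (split 3 8 (red 1 3
  8) (blue 3 6 5 8)) (blue 2 6 5 8)) (blue 1 7 5 8))) (blue 1 4 7 5)) (blue 0 4 1 7))) (blue 1 6 5
  7))) (blue 2 3 6 5))) (split 2 5 (split 5 6 (split 5 7 (red 2 5 7) (blue 0 4 7 5)) (blue 0 3 6
  5)) (blue 0 3 2 5)))) (blue 0 3 2 6))) (split 1 6 (split 1 4 (red 1 4 6) (split 0 7 (split 0 5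
  (split 5 7 (red 0 5 7) (split 5 6 (split 0 6 (red 0 5 6) (split 1 5 (red 1 5 6) (split 2 3 (split
  2 5 (split 4 7 (split 2 8 (split 3 8 (red 2 3 8) (split 0 8 (split 4 8 (red 2 4 8) (blue 0 3 8
  4)) (blue 0 6 3 8))) (split 0 8 (split 1 8 (split 3 8 (red 1 3 8) (blue 2 6 3 8)) (blue 1 7 2 8))
  (blue 0 6 2 8))) (blue 1 4 7 5)) (blue 1 5 2 7)) (blue 0 3 2 6)))) (blue 2 6 5 7))) (split 1 5
  (split 5 6 (red 1 5 6) (blue 0 3 6 5)) (blue 0 4 1 5))) (blue 0 4 1 7))) (blue 1 6 2 7)))) (split
  2 7 (split 4 7 (red 2 4 7) (blue 0 3 7 4)) (blue 2 6 3 7)))) (split 2 3 (split 3 7 (split 1 7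
  (red 1 3 7) (split 2 7 (red 2 3 7) (split 0 7 (split 1 4 (split 1 6 (red 1 4 6) (split 2 6 (split
  1 8 (split 3 8 (red 1 3 8) (split 4 8 (red 1 4 8) (blue 0 3 8 4))) (split 2 8 (split 3 8 (red 2 3
  8) (blue 1 6 3 8)) (blue 1 7 2 8))) (blue 1 6 2 7))) (blue 1 4 2 7)) (blue 0 4 2 7)))) (split 4 7
  (split 3 8 (split 1 8 (red 1 3 8) (split 2 8 (red 2 3 8) (split 0 8 (split 1 4 (split 1 6 (red 1
  4 6) (split 1 7 (red 1 4 7) (blue 1 6 3 7))) (blue 1 4 2 8)) (blue 0 4 2 8)))) (split 4 8 (split
  3 9 (split 1 9 (red 1 3 9) (split 2 9 (red 2 3 9) (split 0 9 (split 1 4 (split 1 6 (red 1 4 6)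
  (split 1 7 (red 1 4 7) (blue 1 6 3 7))) (blue 1 4 2 9)) (blue 0 4 2 9)))) (split 4 9 (split 1 4
  (split 1 6 (red 1 4 6) (split 1 7 (red 1 4 7) (blue 1 6 3 7))) (split 0 5 (split 0 6 (split 5 6
  (red 0 5 6) (split 5 7 (split 0 7 (red 0 5 7) (split 0 8 (split 0 9 (split 1 7 (split 1 5 (red 1
  5 7) (split 2 5 (split 2 7 (red 2 5 7) (blue 0 4 2 7)) (blue 1 4 2 5))) (blue 0 4 1 7)) (blue 0 7
  3 9)) (blue 0 7 3 8))) (blue 3 6 5 7))) (split 0 7 (split 0 8 (split 0 9 (split 1 6 (split 2 6
  (split 5 7 (red 0 5 7) (split 5 6 (split 1 5 (red 1 5 6) (split 2 5 (red 2 5 6) (blue 1 4 2 5)))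
  (blue 3 6 5 7))) (blue 0 4 2 6)) (blue 0 4 1 6)) (blue 0 6 3 9)) (blue 0 6 3 8)) (blue 0 6 3 7)))
  (split 1 5 (split 2 5 (split 5 6 (split 1 6 (red 1 5 6) (split 0 6 (split 1 7 (split 1 8 (split 1
  9 (split 2 6 (red 2 5 6) (blue 1 4 2 6)) (blue 1 6 3 9)) (blue 1 6 3 8)) (blue 1 6 3 7)) (blue 0
  4 1 6))) (blue 0 3 6 5)) (blue 0 4 2 5)) (blue 0 4 1 5)))) (blue 0 3 9 4))) (blue 0 3 8 4)))
  (blue 0 3 7 4))) (blue 0 3 2 4))) (blue 0 3 6 4))) (split 1 4 (split 1 6 (split 4 6 (red 1 4 6)
  (split 3 6 (split 2 3 (split 2 6 (red 2 3 6) (split 4 7 (split 1 7 (red 1 4 7) (split 0 7 (split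
  0 5 (split 5 7 (red 0 5 7) (split 2 7 (split 2 4 (red 2 4 7) (split 0 6 (split 3 7 (red 2 3 7)
  (split 1 5 (split 5 6 (red 0 5 6) (split 2 5 (split 5 8 (split 0 8 (red 0 5 8) (split 1 8 (red 1
  5 8) (blue 0 3 1 8))) (split 1 8 (split 2 8 (split 3 8 (red 2 3 8) (blue 3 7 5 8)) (blue 2 6 5
  8)) (blue 1 7 5 8))) (blue 2 4 6 5))) (blue 1 3 7 5))) (blue 0 4 2 6))) (split 5 6 (split 0 6
  (red 0 5 6) (split 1 5 (red 1 5 6) (split 2 4 (split 2 5 (split 3 7 (split 2 8 (split 3 8 (red 2
  3 8) (split 4 8 (red 2 4 8) (blue 0 3 8 4))) (split 0 8 (split 1 8 (split 4 8 (red 1 4 8) (blue 2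
  6 4 8)) (blue 1 7 2 8)) (blue 0 6 2 8))) (blue 1 3 7 5)) (blue 1 5 2 7)) (blue 0 4 2 6)))) (blue
  2 6 5 7)))) (split 1 5 (split 5 6 (red 1 5 6) (blue 0 4 6 5)) (blue 0 3 1 5))) (blue 0 3 1 7)))
  (split 2 7 (split 3 7 (red 2 3 7) (blue 0 3 7 4)) (blue 2 6 4 7)))) (split 2 4 (split 1 5 (split
  5 6 (red 1 5 6) (split 0 5 (split 4 7 (split 1 7 (red 1 4 7) (split 0 7 (split 2 7 (red 2 4 7)
  (blue 1 3 2 7)) (blue 0 3 1 7))) (split 3 7 (split 5 7 (split 0 7 (red 0 5 7) (split 0 6 (split 1
  7 (red 1 5 7) (blue 0 3 1 7)) (blue 0 6 4 7))) (blue 4 6 5 7)) (blue 0 3 7 4))) (blue 0 4 6 5)))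
  (split 0 5 (split 2 5 (split 2 7 (split 4 7 (red 2 4 7) (split 3 7 (split 5 7 (red 2 5 7) (split
  5 6 (split 0 6 (red 0 5 6) (split 0 7 (split 2 6 (red 2 5 6) (blue 0 3 2 6)) (blue 0 6 4 7)))
  (blue 4 6 5 7))) (blue 0 3 7 4))) (split 0 7 (split 1 7 (split 4 7 (red 1 4 7) (split 2 6 (split
  3 7 (split 5 6 (red 2 5 6) (split 5 7 (red 0 5 7) (blue 4 6 5 7))) (blue 0 3 7 4)) (blue 2 6 4
  7))) (blue 1 3 2 7)) (blue 0 3 2 7))) (blue 1 3 2 5)) (blue 0 3 1 5))) (blue 0 3 2 4))) (blue 0 3
  6 4))) (split 0 6 (split 0 5 (split 5 6 (red 0 5 6) (split 1 7 (split 4 7 (red 1 4 7) (split 3 7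
  (split 2 3 (split 2 7 (red 2 3 7) (split 5 7 (split 0 7 (red 0 5 7) (split 1 5 (red 1 5 7) (split
  2 4 (split 3 6 (split 2 6 (red 2 3 6) (split 2 5 (split 4 6 (split 2 8 (split 3 8 (red 2 3 8)
  (split 4 8 (red 2 4 8) (blue 0 3 8 4))) (split 0 8 (split 1 8 (split 4 8 (red 1 4 8) (blue 2 7 4
  8)) (blue 1 6 2 8)) (blue 0 7 2 8))) (blue 2 6 4 7)) (blue 1 5 2 6))) (blue 1 3 6 5)) (blue 0 4 2
  7)))) (split 2 6 (split 3 6 (red 2 3 6) (split 1 5 (split 4 6 (split 2 4 (red 2 4 6) (split 0 7
  (split 2 5 (split 5 8 (split 0 8 (red 0 5 8) (split 1 8 (red 1 5 8) (blue 0 3 1 8))) (split 1 8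
  (split 2 8 (split 3 8 (red 2 3 8) (blue 3 6 5 8)) (blue 2 7 5 8)) (blue 1 6 5 8))) (blue 2 4 7
  5)) (blue 0 4 2 7))) (blue 4 6 5 7)) (blue 1 3 6 5))) (blue 2 6 5 7)))) (split 2 4 (split 2 6
  (split 4 6 (red 2 4 6) (split 3 6 (split 5 7 (split 0 7 (red 0 5 7) (split 1 5 (red 1 5 7) (split
  2 5 (split 2 7 (red 2 5 7) (blue 0 3 2 7)) (blue 1 3 2 5)))) (blue 4 6 5 7)) (blue 0 3 6 4)))
  (blue 1 3 2 6)) (blue 0 3 2 4))) (blue 0 3 7 4))) (split 0 7 (split 5 7 (red 0 5 7) (blue 1 6 5
  7)) (blue 0 3 1 7)))) (split 1 5 (split 1 7 (split 4 7 (red 1 4 7) (split 3 7 (split 5 7 (red 1 5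
  7) (blue 0 4 7 5)) (blue 0 3 7 4))) (split 0 7 (split 1 8 (split 4 8 (red 1 4 8) (split 3 8
  (split 5 8 (red 1 5 8) (blue 0 4 8 5)) (blue 0 3 8 4))) (split 0 8 (split 1 9 (split 4 9 (red 1 4
  9) (split 3 9 (split 5 9 (red 1 5 9) (blue 0 4 9 5)) (blue 0 3 9 4))) (split 0 9 (split 2 3
  (split 3 6 (split 2 6 (red 2 3 6) (split 2 7 (split 2 8 (split 2 9 (split 3 7 (red 2 3 7) (split
  3 8 (red 2 3 8) (blue 1 7 3 8))) (blue 1 6 2 9)) (blue 1 6 2 8)) (blue 1 6 2 7))) (split 3 7
  (split 2 7 (red 2 3 7) (split 2 6 (split 2 8 (split 2 9 (split 3 8 (red 2 3 8) (blue 1 6 3 8))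
  (blue 1 7 2 9)) (blue 1 7 2 8)) (blue 1 6 2 7))) (blue 1 6 3 7))) (split 2 4 (split 2 5 (split 2
  6 (split 2 7 (split 2 8 (split 2 9 (split 4 6 (red 2 4 6) (split 3 6 (split 4 7 (red 2 4 7) (blue
  1 6 4 7)) (blue 0 3 6 4))) (blue 1 3 2 9)) (blue 1 3 2 8)) (blue 1 3 2 7)) (blue 1 3 2 6)) (blue
  0 3 2 5)) (blue 0 3 2 4))) (blue 0 3 1 9))) (blue 0 3 1 8))) (blue 0 3 1 7))) (blue 0 3 1 5)))
  (blue 0 3 1 6))) (blue 0 3 1 4))))

valid-certificate : Valid [] certificate
valid-certificate = from-yes (valid? [] certificate)

lemma6 : (c : Colouring) → HasRedC3 c ⊎ HasBlueC4 c
lemma6 c = valid⇒red⊎blue c certificate [] valid-certificate
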